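{- Let $k\ge 2$ and let $C_{2k}$ be the cycle graph with vertex set $V=\{1,\dots,2k\}$ and edges $\{i,i+1\}$ (indices mod $2k$). Fix a vertex $v_0$. The facets of $\mathcal{P}_{C_{2k}}$ are in bijection with the functions $f:V\to\mathbb{Z}$ such that $f(v_0)=0$ and $|f(i)-f(i+1)|=1$ for all $i$ (indices mod $2k$), via $f\mapsto\{x\in\mathcal{P}_{C_{2k}}:\sum_{v}f(v)x_v=1\}$. The polytope $\mathcal{P}_{C_{2k}}$ has $\binom{2k}{k}$ facets, and each facet is $(2k-2)$-dimensional and has $2k$ vertices.
   Context: For a graph $G=(V,E)$, the symmetric edge polytope is $\mathcal{P}_G:=\mathrm{conv}\{\mathbf{e}_v-\mathbf{e}_w,\ \mathbf{e}_w-\mathbf{e}_v : \{v,w\}\in E\}\subset\mathbb{R}^V$.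
   Formalization: The symmetric edge polytope $\mathcal{P}_{C_{2k}}$, its faces, their dimensions and their vertices are taken over the rationals, with rational points and normals, instead of in $\mathbb{R}^V$. -}

module Defs where

open import Data.Nat as ℕ using (ℕ; zero; suc)
open import Data.Integer as ℤ using (ℤ)
open import Data.Rational using (ℚ; 0ℚ; 1ℚ; _+_; _*_; _-_; _≤_; _/_)
open import Data.Fin using (Fin; zero; suc; _≟_; splitAt)
open import Data.Bool using (if_then_else_)
open import Data.Sum using (_⊎_; inj₁; inj₂)
open import Data.Product using (Σ; _×_; _,_; ∃)
open import Relation.Nullary using (¬_; does)
open import Relation.Binary.PropositionalEquality using (_≡_)

-- Points of ℚ^n (the vertex set V is identified with Fin n).
Pt : ℕ → Set
Pt n = Fin n → ℚ

_≈P_ : ∀ {n} → Pt n → Pt n → Set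
x ≈P y = ∀ i → x i ≡ y i

sumFin : ∀ {n} → (Fin n → ℚ) → ℚ
sumFin {zero}  f = 0ℚ
sumFin {suc n} f = f zero + sumFin (λ i → f (suc i))

dot : ∀ {n} → Pt n → Pt n → ℚ
dot a x = sumFin (λ i → a i * x i)

PSet : ℕ → Set₁
PSet n = Pt n → Set

_≐_ : ∀ {n} → PSet n → PSet n → Set
F ≐ G = ∀ x → (F x → G x) × (G x → F x)

Conv : ∀ {n N} → (Fin N → Pt n) → PSet n
Conv {n} {N} p x =
  Σ (Fin N → ℚ) λ λs →
    (∀ j → 0ℚ ≤ λs j) × (sumFin λs ≡ 1ℚ) × (∀ i → x i ≡ sumFin (λ j → λs j * p j i))

e : ∀ {n} → Fin n → Pt n
e v u = if does (u ≟ v) then 1ℚ else 0ℚ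

-- Symmetric edge polytope of a graph given by a family of edges E : Fin m → V × V :
-- conv { e_v - e_w , e_w - e_v : {v,w} ∈ E }.
sepGens : ∀ {n m} → (Fin m → Fin n × Fin n) → Fin (m ℕ.+ m) → Pt n
sepGens {n} {m} E j with splitAt m j
... | inj₁ a with E a
...   | (v , w) = λ u → e v u - e w u
sepGens {n} {m} E j | inj₂ a with E a
...   | (v , w) = λ u → e w u - e v u

SEP : ∀ {n m} → (Fin m → Fin n × Fin n) → PSet n
SEP E = Conv (sepGens E)

-- Cyclic successor on Fin n (i ↦ i+1 mod n).
nextS : ∀ {n} → Fin (suc n) → Fin (suc n)
nextS {zero}  zero    = zero
nextS {suc n} zero    = suc zero
nextS {suc n} (suc i) with nextS i
... | zero  = zero
... | suc j = suc (suc j)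

next : ∀ {n} → Fin n → Fin n
next {suc n} i = nextS i

cycleEdges : (n : ℕ) → Fin n → Fin n × Fin n
cycleEdges n i = (i , next i)

IsFace : ∀ {n} → PSet n → PSet n → Set
IsFace {n} P F =
  Σ (Pt n) λ a → Σ ℚ λ c →
    (∀ y → P y → dot a y ≤ c) × (F ≐ (λ x → P x × (dot a x ≡ c)))

AffInd : ∀ {n m} → (Fin m → Pt n) → Set
AffInd {n} {m} p =
  (μ : Fin m → ℚ) → sumFin μ ≡ 0ℚ →
  (∀ i → sumFin (λ j → μ j * p j i) ≡ 0ℚ) → ∀ j → μ j ≡ 0ℚ

HasDim : ∀ {n} → PSet n → ℕ → Set
HasDim {n} S d =
  (Σ (Fin (suc d) → Pt n) λ p → (∀ j → S (p j)) × AffInd p) ×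
  ((p : Fin (suc (suc d)) → Pt n) → (∀ j → S (p j)) → ¬ AffInd p)

IsFacet : ∀ {n} → PSet n → PSet n → Set
IsFacet P F = IsFace P F × ∃ λ d → HasDim P (suc d) × HasDim F d

IsVertex : ∀ {n} → PSet n → Pt n → Set
IsVertex {n} F x =
  F x × Σ (Pt n) λ a → Σ ℚ λ c →
    (∀ y → F y → dot a y ≤ c) × (dot a x ≡ c) × (∀ y → F y → dot a y ≡ c → y ≈P x)

HasNVertices : ∀ {n} → PSet n → ℕ → Set
HasNVertices {n} F N =
  Σ (Fin N → Pt n) λ p →
    (∀ j → IsVertex F (p j)) ×
    (∀ j j' → p j ≈P p j' → j ≡ j') ×
    (∀ x → IsVertex F x → ∃ λ j → p j ≈P x)

toℚ : ℤ → ℚ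
toℚ z = z / 1

Admissible : ∀ {n} → Fin n → (Fin n → ℤ) → Set
Admissible v0 f = (f v0 ≡ ℤ.0ℤ) × (∀ i → ℤ.∣ f i ℤ.- f (next i) ∣ ≡ 1)

faceOf : ∀ {n} → PSet n → (Fin n → ℤ) → PSet n
faceOf P f x = P x × (dot (λ v → toℚ (f v)) x ≡ 1ℚ)

module Submission where

-- Write P for the symmetric edge polytope of C_n (n = 2k) and ±(e_a - e_(a+1)) for its generators.
-- An admissible f, read as a functional, takes the values ±1 on the two generators of each edge, so
-- f·x ≤ 1 is valid on P; the face f·x = 1 is the convex hull of the n tight generators, which satisfy
-- exactly one affine relation (their signed sum telescopes to 0). Hence it has dimension n - 2, these
-- n points are its vertices, and P itself has dimension n - 1.
-- Conversely, let a·x ≤ c define a facet. Every slope a_i - a_(i+1) lies in [-c, c], and c > 0. If two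
-- slopes are strictly inside, the facet lies in the affine span of only n - 2 generators; if exactly
-- one is, then, as the slopes sum to 0 around the cycle, it is c times a sum of n - 1 signs, an odd
-- and hence nonzero multiple of c, which inside [-c, c] is impossible. So all slopes are ±c, and the
-- facet is the face of the labeling obtained by summing these signs along the cycle from v0. Facets
-- thus correspond to sign vectors with k entries +1.

open import Defs
import Data.Nat as ℕ
open import Data.Nat using (ℕ; zero; suc; z≤n; s≤s)
import Data.Nat.Properties as ℕ
open import Data.Nat.Combinatorics using (_C_; nCk+nC[k+1]≡[n+1]C[k+1])
import Data.Integer as ℤ
import Data.Integer.Properties as ℤ
open import Data.Integer using (ℤ; -[1+_])
open import Data.Integer.Tactic.RingSolver using (solve-∀)
open import Data.Rational
open import Data.Rational.Properties
open import Data.Rational.Solver using (module +-*-Solver)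
import Data.Rational.Unnormalised as ℚᵘ
import Data.Rational.Unnormalised.Properties as ℚᵘ
open import Data.Fin as Fin using (Fin; zero; suc; punchIn; punchOut; inject₁; fromℕ; toℕ; splitAt; _↑ˡ_; _↑ʳ_; cast; join)
open import Data.Fin.Properties using (all?; ¬∀⟶∃¬; punchIn-punchOut; punchInᵢ≢i; suc-injective; toℕ-inject₁; toℕ-fromℕ; splitAt-↑ˡ; splitAt-↑ʳ; splitAt⁻¹-↑ˡ; splitAt⁻¹-↑ʳ; splitAt-join; join-splitAt; cast-involutive)
import Data.Fin.Induction as Fin
open import Data.Vec.Functional using (_∷_)
open import Data.Product using (Σ; _×_; _,_; ∃; proj₁; proj₂; uncurry)
open import Data.Bool using (Bool; true; false; if_then_else_)
import Data.Bool
import Data.Sum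
open import Data.Sum using (_⊎_; inj₁; inj₂)
open import Relation.Nullary using (¬_; Dec; does; yes; no)
open import Relation.Nullary.Decidable using (_⊎-dec_; toWitness; toWitnessFalse; decidable-stable; dec-true; dec-false)
open import Relation.Binary using (tri<; tri≈; tri>)
open import Data.Empty using (⊥; ⊥-elim)
open import Function using (case_of_; id)
open import Relation.Binary.PropositionalEquality
open +-*-Solver
open import Algebra.Properties.Group +-0-group using (x∙y⁻¹≈ε⇒x≈y; ⁻¹-involutive; inverseˡ-unique; inverseʳ-unique)

sumFin-cong : ∀ {n} {f g : Fin n → ℚ} → (∀ i → f i ≡ g i) → sumFin f ≡ sumFin g
sumFin-cong {zero}  h = refl
sumFin-cong {suc n} h = cong₂ _+_ (h zero) (sumFin-cong (λ i → h (suc i)))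

sumFin-zero : ∀ {n} {f : Fin n → ℚ} → (∀ i → f i ≡ 0ℚ) → sumFin f ≡ 0ℚ
sumFin-zero {zero}  h = refl
sumFin-zero {suc n} h = trans (cong₂ _+_ (h zero) (sumFin-zero (λ i → h (suc i)))) (+-identityˡ 0ℚ)

sumFin-+ : ∀ {n} (f g : Fin n → ℚ) → sumFin (λ i → f i + g i) ≡ sumFin f + sumFin g
sumFin-+ {zero}  f g = refl
sumFin-+ {suc n} f g =
  trans (cong (f zero + g zero +_) (sumFin-+ (λ i → f (suc i)) (λ i → g (suc i))))
        (interchange (f zero) (g zero) _ _)
  where
  interchange : ∀ a b c d → a + b + (c + d) ≡ a + c + (b + d)
  interchange = solve 4 (λ a b c d → a :+ b :+ (c :+ d) := a :+ c :+ (b :+ d)) refl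

sumFin-*ˡ : ∀ {n} (c : ℚ) (f : Fin n → ℚ) → sumFin (λ i → c * f i) ≡ c * sumFin f
sumFin-*ˡ {zero}  c f = sym (*-zeroʳ c)
sumFin-*ˡ {suc n} c f =
  trans (cong (c * f zero +_) (sumFin-*ˡ c (λ i → f (suc i)))) (sym (*-distribˡ-+ c (f zero) _))

sumFin-*ʳ : ∀ {n} (c : ℚ) (f : Fin n → ℚ) → sumFin (λ i → f i * c) ≡ sumFin f * c
sumFin-*ʳ c f = trans (sumFin-cong (λ i → *-comm (f i) c)) (trans (sumFin-*ˡ c f) (*-comm c _))

sumFin-neg : ∀ {n} (f : Fin n → ℚ) → sumFin (λ i → - f i) ≡ - sumFin f
sumFin-neg {zero}  f = refl
sumFin-neg {suc n} f =
  trans (cong (- f zero +_) (sumFin-neg (λ i → f (suc i)))) (sym (neg-distrib-+ (f zero) _))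

sumFin-- : ∀ {n} (f g : Fin n → ℚ) → sumFin (λ i → f i - g i) ≡ sumFin f - sumFin g
sumFin-- f g = trans (sumFin-+ f (λ i → - g i)) (cong (sumFin f +_) (sumFin-neg g))

sumFin-comm : ∀ {n m} (f : Fin n → Fin m → ℚ) →
  sumFin (λ i → sumFin (f i)) ≡ sumFin (λ j → sumFin (λ i → f i j))
sumFin-comm {zero}  {m} f = sym (sumFin-zero {m} (λ _ → refl))
sumFin-comm {suc n} {m} f =
  trans (cong (sumFin (f zero) +_) (sumFin-comm (λ i → f (suc i))))
        (sym (sumFin-+ (f zero) (λ j → sumFin (λ i → f (suc i) j))))

sumFin-punchIn : ∀ {n} (i : Fin (suc n)) (f : Fin (suc n) → ℚ) →
  sumFin f ≡ f i + sumFin (λ j → f (punchIn i j))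
sumFin-punchIn zero f = refl
sumFin-punchIn {suc n} (suc i) f =
  trans (cong (f zero +_) (sumFin-punchIn i (λ j → f (suc j)))) (swap (f zero) (f (suc i)) _)
  where
  swap : ∀ a b c → a + (b + c) ≡ b + (a + c)
  swap = solve 3 (λ a b c → a :+ (b :+ c) := b :+ (a :+ c)) refl

sumFin-single : ∀ {n} (f : Fin (suc n) → ℚ) i → (∀ j → j ≢ i → f j ≡ 0ℚ) → sumFin f ≡ f i
sumFin-single f i h =
  trans (sumFin-punchIn i f)
        (trans (cong (f i +_) (sumFin-zero (λ j → h (punchIn i j) (punchInᵢ≢i i j)))) (+-identityʳ (f i)))

sumFin-nonNeg : ∀ {n} (f : Fin n → ℚ) → (∀ i → 0ℚ ≤ f i) → 0ℚ ≤ sumFin f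
sumFin-nonNeg {zero}  f h = ≤-refl
sumFin-nonNeg {suc n} f h = +-mono-≤ (h zero) (sumFin-nonNeg _ (λ i → h (suc i)))

sumFin-mono-≤ : ∀ {n} (f g : Fin n → ℚ) → (∀ i → f i ≤ g i) → sumFin f ≤ sumFin g
sumFin-mono-≤ {zero}  f g h = ≤-refl
sumFin-mono-≤ {suc n} f g h = +-mono-≤ (h zero) (sumFin-mono-≤ _ _ (λ i → h (suc i)))

nonNeg+nonNeg≡0⇒≡0 : ∀ {a b} → 0ℚ ≤ a → 0ℚ ≤ b → a + b ≡ 0ℚ → a ≡ 0ℚ
nonNeg+nonNeg≡0⇒≡0 {a} ha hb eq = ≤-antisym (subst₂ _≤_ (+-identityʳ a) eq (+-monoʳ-≤ a hb)) ha

sumFin-nonNeg≡0 : ∀ {n} (f : Fin n → ℚ) → (∀ i → 0ℚ ≤ f i) → sumFin f ≡ 0ℚ → ∀ i → f i ≡ 0ℚ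
sumFin-nonNeg≡0 {suc n} f h eq zero =
  nonNeg+nonNeg≡0⇒≡0 (h zero) (sumFin-nonNeg _ (λ i → h (suc i))) eq
sumFin-nonNeg≡0 {suc n} f h eq (suc i) =
  sumFin-nonNeg≡0 (λ i → f (suc i)) (λ i → h (suc i))
    (nonNeg+nonNeg≡0⇒≡0 (sumFin-nonNeg _ (λ i → h (suc i))) (h zero) (trans (+-comm _ (f zero)) eq)) i

*-nonZero : ∀ p q → p ≢ 0ℚ → q ≢ 0ℚ → p * q ≢ 0ℚ
*-nonZero p q p≢0 q≢0 pq≡0 = q≢0 (begin
  q                ≡⟨ sym (*-identityˡ q) ⟩
  1ℚ * q           ≡⟨ cong (_* q) (sym (*-inverseˡ p)) ⟩
  (1/ p) * p * q   ≡⟨ *-assoc (1/ p) p q ⟩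
  (1/ p) * (p * q) ≡⟨ cong ((1/ p) *_) pq≡0 ⟩
  (1/ p) * 0ℚ      ≡⟨ *-zeroʳ (1/ p) ⟩
  0ℚ               ∎)
  where open ≡-Reasoning
        instance _ = ≢-nonZero p≢0

*≡0⇒≡0⊎≡0 : ∀ p q → p * q ≡ 0ℚ → p ≡ 0ℚ ⊎ q ≡ 0ℚ
*≡0⇒≡0⊎≡0 p q pq≡0 with p ≟ 0ℚ | q ≟ 0ℚ
... | yes p≡0 | _       = inj₁ p≡0
... | no _    | yes q≡0 = inj₂ q≡0
... | no p≢0  | no q≢0  = ⊥-elim (*-nonZero p q p≢0 q≢0 pq≡0)

p*q≡0⇒q≡0 : ∀ {p q} → p ≢ 0ℚ → p * q ≡ 0ℚ → q ≡ 0ℚ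
p*q≡0⇒q≡0 {p} {q} p≢0 pq≡0 = decidable-stable (q ≟ 0ℚ) (λ q≢0 → *-nonZero p q p≢0 q≢0 pq≡0)

p*q≡0⇒p≡0 : ∀ {p q} → q ≢ 0ℚ → p * q ≡ 0ℚ → p ≡ 0ℚ
p*q≡0⇒p≡0 {p} {q} q≢0 pq≡0 = p*q≡0⇒q≡0 q≢0 (trans (*-comm q p) pq≡0)

nonNeg*nonNeg : ∀ {a b} → 0ℚ ≤ a → 0ℚ ≤ b → 0ℚ ≤ a * b
nonNeg*nonNeg {a} {b} 0≤a 0≤b =
  subst (_≤ a * b) (*-zeroʳ a) (*-monoˡ-≤-nonNeg a {{nonNegative 0≤a}} 0≤b)

*-monoˡ-≤ : ∀ {r p q} → 0ℚ ≤ r → p ≤ q → r * p ≤ r * q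
*-monoˡ-≤ {r} 0≤r = *-monoˡ-≤-nonNeg r {{nonNegative 0≤r}}

p≤q⇒0≤q-p : ∀ {p q} → p ≤ q → 0ℚ ≤ q - p
p≤q⇒0≤q-p {p} {q} p≤q = subst (_≤ q - p) (+-inverseʳ p) (+-monoˡ-≤ (- p) p≤q)

p-q≡0⇒p≡q : ∀ {p q} → p - q ≡ 0ℚ → p ≡ q
p-q≡0⇒p≡q {p} {q} = x∙y⁻¹≈ε⇒x≈y p q

0≤1 : 0ℚ ≤ 1ℚ
0≤1 = toWitness {a? = 0ℚ ≤? 1ℚ} _

0<1 : 0ℚ < 1ℚ
0<1 = toWitness {a? = 0ℚ <? 1ℚ} _

x*[y*z]≡y*[x*z] : ∀ x y z → x * (y * z) ≡ y * (x * z)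
x*[y*z]≡y*[x*z] = solve 3 (λ x y z → x :* (y :* z) := y :* (x :* z)) refl

*-distribˡ-- : ∀ x y z → x * (y - z) ≡ x * y - x * z
*-distribˡ-- = solve 3 (λ x y z → x :* (y :- z) := x :* y :- x :* z) refl

-1*x≡-x : ∀ x → - 1ℚ * x ≡ - x
-1*x≡-x = solve 1 (λ x → :- con 1ℚ :* x := :- x) refl

-1*x≡c⇒x≡-c : ∀ {x c} → - 1ℚ * x ≡ c → x ≡ - c
-1*x≡c⇒x≡-c {x} -x≡c = trans (sym (⁻¹-involutive x)) (cong -_ (trans (sym (-1*x≡-x x)) -x≡c))

1≰0 : ¬ (1ℚ ≤ 0ℚ)
1≰0 = toWitnessFalse {a? = 1ℚ ≤? 0ℚ} _

-1≤1 : - 1ℚ ≤ 1ℚ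
-1≤1 = toWitness {a? = - 1ℚ ≤? 1ℚ} _

e-diagonal : ∀ {n} (v : Fin n) → e v v ≡ 1ℚ
e-diagonal zero    = refl
e-diagonal (suc v) = e-diagonal v

e-offDiagonal : ∀ {n} (v u : Fin n) → u ≢ v → e v u ≡ 0ℚ
e-offDiagonal v u u≢v with u Fin.≟ v
... | yes u≡v = ⊥-elim (u≢v u≡v)
... | no _    = refl

e-sym : ∀ {n} (v u : Fin n) → e v u ≡ e u v
e-sym zero    zero    = refl
e-sym zero    (suc u) = refl
e-sym (suc v) zero    = refl
e-sym (suc v) (suc u) = e-sym v u

EValue : ∀ {n} → Fin n → Fin n → Set
EValue v u = (u ≡ v × e v u ≡ 1ℚ) ⊎ (u ≢ v × e v u ≡ 0ℚ)

e-value : ∀ {n} (v u : Fin n) → EValue v u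
e-value v u = case u Fin.≟ v of λ where
  (yes refl) → inj₁ (refl , e-diagonal u)
  (no u≢v)   → inj₂ (u≢v , e-offDiagonal v u u≢v)

e-nonNeg : ∀ {n} (v u : Fin n) → 0ℚ ≤ e v u
e-nonNeg v u with u Fin.≟ v
... | yes _ = 0≤1
... | no _  = ≤-refl

sumFin-*e : ∀ {n} (v : Fin n) (a : Fin n → ℚ) → sumFin (λ u → a u * e v u) ≡ a v
sumFin-*e {suc n} zero a =
  trans (cong₂ _+_ (*-identityʳ (a zero)) (sumFin-zero (λ i → *-zeroʳ (a (suc i))))) (+-identityʳ (a zero))
sumFin-*e {suc n} (suc v) a =
  trans (cong₂ _+_ (*-zeroʳ (a zero)) (sumFin-*e v (λ i → a (suc i)))) (+-identityˡ _)

sumFin-e* : ∀ {n} (v : Fin n) (a : Fin n → ℚ) → sumFin (λ u → e v u * a u) ≡ a v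
sumFin-e* v a = trans (sumFin-cong (λ u → *-comm (e v u) (a u))) (sumFin-*e v a)

dot-cong : ∀ {n} (b : Pt n) {x y : Pt n} → x ≈P y → dot b x ≡ dot b y
dot-cong b x≈y = sumFin-cong (λ i → cong (b _ *_) (x≈y i))

module _ {n N : ℕ} (p : Fin N → Pt n) where

  dot-Conv : ∀ (b : Pt n) {x} (cx : Conv p x) → dot b x ≡ sumFin (λ j → proj₁ cx j * dot b (p j))
  dot-Conv b {x} (λs , _ , _ , x≡) = begin
    sumFin (λ i → b i * x i)
      ≡⟨ sumFin-cong (λ i → cong (b i *_) (x≡ i)) ⟩
    sumFin (λ i → b i * sumFin (λ j → λs j * p j i))
      ≡⟨ sumFin-cong (λ i → sym (sumFin-*ˡ (b i) (λ j → λs j * p j i))) ⟩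
    sumFin (λ i → sumFin (λ j → b i * (λs j * p j i)))
      ≡⟨ sumFin-comm (λ i j → b i * (λs j * p j i)) ⟩
    sumFin (λ j → sumFin (λ i → b i * (λs j * p j i)))
      ≡⟨ sumFin-cong (λ j → trans (sumFin-cong (λ i → x*[y*z]≡y*[x*z] (b i) (λs j) (p j i))) (sumFin-*ˡ (λs j) (λ i → b i * p j i))) ⟩
    sumFin (λ j → λs j * dot b (p j)) ∎
    where open ≡-Reasoning

  weighted-const : ∀ {x} (cx : Conv p x) c → sumFin (λ j → proj₁ cx j * c) ≡ c
  weighted-const (λs , _ , Σλ≡1 , _) c = trans (sumFin-*ʳ c λs) (trans (cong (_* c) Σλ≡1) (*-identityˡ c))

  Conv-valid : ∀ (b : Pt n) c → (∀ j → dot b (p j) ≤ c) → ∀ x → Conv p x → dot b x ≤ c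
  Conv-valid b c valid x cx@(λs , λ≥0 , _ , _) =
    subst₂ _≤_ (sym (dot-Conv b cx)) (weighted-const cx c)
      (sumFin-mono-≤ (λ j → λs j * dot b (p j)) (λ j → λs j * c) (λ j → *-monoˡ-≤ (λ≥0 j) (valid j)))

  dot-Conv-proportional : ∀ (a b : Pt n) c → (∀ j → dot a (p j) ≡ c * dot b (p j)) →
    ∀ {x} → Conv p x → dot a x ≡ c * dot b x
  dot-Conv-proportional a b c proportional {x} x∈P@(λs , _) = begin
    dot a x
      ≡⟨ dot-Conv a x∈P ⟩
    sumFin (λ j → λs j * dot a (p j))
      ≡⟨ sumFin-cong (λ j → trans (cong (λs j *_) (proportional j)) (x*[y*z]≡y*[x*z] (λs j) c (dot b (p j)))) ⟩
    sumFin (λ j → c * (λs j * dot b (p j)))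
      ≡⟨ sumFin-*ˡ c (λ j → λs j * dot b (p j)) ⟩
    c * sumFin (λ j → λs j * dot b (p j))
      ≡⟨ cong (c *_) (sym (dot-Conv b x∈P)) ⟩
    c * dot b x ∎
    where open ≡-Reasoning

  Conv-slack-sum : ∀ (b : Pt n) c x (cx : Conv p x) → dot b x ≡ c →
    sumFin (λ j → proj₁ cx j * (c - dot b (p j))) ≡ 0ℚ
  Conv-slack-sum b c x cx bx≡c = begin
    sumFin (λ j → λs j * (c - dot b (p j)))
      ≡⟨ sumFin-cong (λ j → *-distribˡ-- (λs j) c (dot b (p j))) ⟩
    sumFin (λ j → λs j * c - λs j * dot b (p j))
      ≡⟨ sumFin-- (λ j → λs j * c) (λ j → λs j * dot b (p j)) ⟩
    sumFin (λ j → λs j * c) - sumFin (λ j → λs j * dot b (p j))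
      ≡⟨ cong₂ _-_ (weighted-const cx c) (sym (dot-Conv b cx)) ⟩
    c - dot b x
      ≡⟨ cong (λ z → c - z) bx≡c ⟩
    c - c
      ≡⟨ +-inverseʳ c ⟩
    0ℚ ∎
    where open ≡-Reasoning
          λs = proj₁ cx

  Conv-tight : ∀ (b : Pt n) c → (∀ j → dot b (p j) ≤ c) → ∀ x (cx : Conv p x) → dot b x ≡ c →
    ∀ j → proj₁ cx j ≡ 0ℚ ⊎ dot b (p j) ≡ c
  Conv-tight b c valid x cx bx≡c j = Data.Sum.map₂ (λ slack≡0 → sym (p-q≡0⇒p≡q slack≡0))
    (*≡0⇒≡0⊎≡0 (proj₁ cx j) (c - dot b (p j))
      (sumFin-nonNeg≡0 (λ j → proj₁ cx j * (c - dot b (p j))) (λ j → nonNeg*nonNeg (proj₁ (proj₂ cx) j) (p≤q⇒0≤q-p (valid j)))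
                       (Conv-slack-sum b c x cx bx≡c) j))

  Conv-generator : ∀ j → Conv p (p j)
  Conv-generator j =
    e j , e-nonNeg j , trans (sumFin-cong (λ u → sym (*-identityˡ (e j u)))) (sumFin-*e j (λ _ → 1ℚ)) ,
    (λ i → sym (sumFin-e* j (λ l → p l i)))

allZero⊎nonZero : ∀ {m} (g : Fin m → ℚ) → (∀ r → g r ≡ 0ℚ) ⊎ ∃ (λ r → g r ≢ 0ℚ)
allZero⊎nonZero {zero}  g = inj₁ (λ ())
allZero⊎nonZero {suc m} g with g zero ≟ 0ℚ | allZero⊎nonZero (λ r → g (suc r))
... | no g0≢0 | _              = inj₂ (zero , g0≢0)
... | yes _   | inj₂ (r , gr≢0) = inj₂ (suc r , gr≢0)
... | yes g0≡0 | inj₁ rest     = inj₁ λ { zero → g0≡0 ; (suc r) → rest r }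

NontrivialSolution : ∀ {m k} → (Fin m → Fin k → ℚ) → Set
NontrivialSolution {m} {k} A =
  Σ (Fin k → ℚ) λ μ → (∃ λ j → μ j ≢ 0ℚ) × (∀ r → sumFin (λ j → A r j * μ j) ≡ 0ℚ)

zeroColumn-solvable : ∀ {m k} (A : Fin m → Fin (suc k) → ℚ) → (∀ r → A r zero ≡ 0ℚ) → NontrivialSolution A
zeroColumn-solvable A column0≡0 = μ , (zero , λ ()) , solves
  where
  μ : Fin (suc _) → ℚ
  μ zero    = 1ℚ
  μ (suc _) = 0ℚ
  solves : ∀ r → sumFin (λ j → A r j * μ j) ≡ 0ℚ
  solves r = trans (cong₂ _+_ (trans (cong (_* 1ℚ) (column0≡0 r)) (*-zeroˡ 1ℚ))
                              (sumFin-zero (λ j → *-zeroʳ (A r (suc j)))))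
                   (+-identityˡ 0ℚ)

eliminateColumn0 : ∀ {m k} → (Fin (suc m) → Fin (suc k) → ℚ) → Fin (suc m) → Fin m → Fin k → ℚ
eliminateColumn0 A r0 r j = A r0 zero * A (punchIn r0 r) (suc j) - A (punchIn r0 r) zero * A r0 (suc j)

back-substitute : ∀ {m k} (A : Fin (suc m) → Fin (suc k) → ℚ) r0 → A r0 zero ≢ 0ℚ →
  NontrivialSolution (eliminateColumn0 A r0) → NontrivialSolution A
back-substitute {m} {k} A r0 pivot≢0 (μ' , (j₁ , μ'j₁≢0) , μ'-solves) =
  μ , (suc j₁ , *-nonZero pivot (μ' j₁) pivot≢0 μ'j₁≢0) , solves
  where
  pivot = A r0 zero
  tail : Fin (suc m) → ℚ
  tail r = sumFin (λ j → A r (suc j) * μ' j)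
  μ : Fin (suc k) → ℚ
  μ zero    = - tail r0
  μ (suc j) = pivot * μ' j
  row : ∀ r → sumFin (λ j → A r j * μ j) ≡ A r zero * (- tail r0) + pivot * tail r
  row r = cong (A r zero * (- tail r0) +_)
    (trans (sumFin-cong (λ j → x*[y*z]≡y*[x*z] (A r (suc j)) pivot (μ' j))) (sumFin-*ˡ pivot (λ j → A r (suc j) * μ' j)))
  reduced : ∀ r → pivot * tail (punchIn r0 r) - A (punchIn r0 r) zero * tail r0 ≡ 0ℚ
  reduced r = begin
    pivot * tail r₁ - A r₁ zero * tail r0
      ≡⟨ cong₂ _-_ (sym (sumFin-*ˡ pivot (λ j → A r₁ (suc j) * μ' j))) (sym (sumFin-*ˡ (A r₁ zero) (λ j → A r0 (suc j) * μ' j))) ⟩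
    sumFin (λ j → pivot * (A r₁ (suc j) * μ' j)) - sumFin (λ j → A r₁ zero * (A r0 (suc j) * μ' j))
      ≡⟨ sym (sumFin-- (λ j → pivot * (A r₁ (suc j) * μ' j)) (λ j → A r₁ zero * (A r0 (suc j) * μ' j))) ⟩
    sumFin (λ j → pivot * (A r₁ (suc j) * μ' j) - A r₁ zero * (A r0 (suc j) * μ' j))
      ≡⟨ sumFin-cong (λ j → sym (regroup pivot (A r₁ (suc j)) (A r₁ zero) (A r0 (suc j)) (μ' j))) ⟩
    sumFin (λ j → eliminateColumn0 A r0 r j * μ' j)
      ≡⟨ μ'-solves r ⟩
    0ℚ ∎
    where open ≡-Reasoning
          r₁ = punchIn r0 r
          regroup : ∀ a b c d x → (a * b - c * d) * x ≡ a * (b * x) - c * (d * x)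
          regroup = solve 5 (λ a b c d x → (a :* b :- c :* d) :* x := a :* (b :* x) :- c :* (d :* x)) refl
  solves : ∀ r → sumFin (λ j → A r j * μ j) ≡ 0ℚ
  solves r with r Fin.≟ r0
  ... | yes refl = trans (row r0) (cancel pivot (tail r0))
    where cancel : ∀ a b → a * (- b) + a * b ≡ 0ℚ
          cancel = solve 2 (λ a b → a :* (:- b) :+ a :* b := con 0ℚ) refl
  ... | no r≢r0 =
    subst (λ r → sumFin (λ j → A r j * μ j) ≡ 0ℚ) (punchIn-punchOut r0≢r)
      (trans (row (punchIn r0 r')) (trans (reorder (A (punchIn r0 r') zero) (tail r0) pivot (tail (punchIn r0 r'))) (reduced r')))
    where r0≢r = λ r0≡r → r≢r0 (sym r0≡r)
          r' = punchOut r0≢r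
          reorder : ∀ a b c d → a * (- b) + c * d ≡ c * d - a * b
          reorder = solve 4 (λ a b c d → a :* (:- b) :+ c :* d := c :* d :- a :* b) refl

underdetermined-solvable : ∀ m (A : Fin m → Fin (suc m) → ℚ) → NontrivialSolution A
underdetermined-solvable zero    A = (λ _ → 1ℚ) , (zero , λ ()) , (λ ())
underdetermined-solvable (suc m) A with allZero⊎nonZero (λ r → A r zero)
... | inj₁ column0≡0      = zeroColumn-solvable A column0≡0
... | inj₂ (r0 , pivot≢0) = back-substitute A r0 pivot≢0 (underdetermined-solvable m (eliminateColumn0 A r0))

HasAffInd : ∀ {n} → PSet n → ℕ → Set
HasAffInd {n} S a = Σ (Fin a → Pt n) λ p → (∀ j → S (p j)) × AffInd p

NoAffInd : ∀ {n} → PSet n → ℕ → Set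
NoAffInd {n} S b = (p : Fin b → Pt n) → (∀ j → S (p j)) → ¬ AffInd p

AffInd-tail : ∀ {n r} (p : Fin (suc r) → Pt n) → AffInd p → AffInd (λ j → p (suc j))
AffInd-tail p ind μ' Σμ'≡0 comb≡0 j =
  ind μ (trans (+-identityˡ _) Σμ'≡0)
    (λ i → trans (cong₂ _+_ (*-zeroˡ (p zero i)) (comb≡0 i)) (+-identityˡ 0ℚ)) (suc j)
  where μ : Fin _ → ℚ
        μ zero    = 0ℚ
        μ (suc j) = μ' j

HasAffInd-≤ : ∀ {n} (S : PSet n) {a b} → b ℕ.≤ a → HasAffInd S a → HasAffInd S b
HasAffInd-≤ S {a} b≤a h with ℕ.m≤n⇒m<n∨m≡n b≤a
... | inj₂ refl = h
HasAffInd-≤ S {suc a} _ (p , p∈S , ind) | inj₁ (s≤s b≤a) =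
  HasAffInd-≤ S b≤a ((λ j → p (suc j)) , (λ j → p∈S (suc j)) , AffInd-tail p ind)

HasAffInd<NoAffInd : ∀ {n} (S : PSet n) {a b} → HasAffInd S a → NoAffInd S b → a ℕ.< b
HasAffInd<NoAffInd S {a} {b} h none with a ℕ.<? b
... | yes a<b = a<b
... | no a≮b with HasAffInd-≤ S (ℕ.≮⇒≥ a≮b) h
...   | (p , p∈S , ind) = ⊥-elim (none p p∈S ind)

HasDim-unique : ∀ {n} (S : PSet n) {d d'} → HasDim S d → HasDim S d' → d ≡ d'
HasDim-unique S (has , none) (has' , none') =
  ℕ.≤-antisym (ℕ.≤-pred (ℕ.≤-pred (HasAffInd<NoAffInd S has none'))) (ℕ.≤-pred (ℕ.≤-pred (HasAffInd<NoAffInd S has' none)))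

≐-sym : ∀ {n} {F G : PSet n} → F ≐ G → G ≐ F
≐-sym F≐G x = proj₂ (F≐G x) , proj₁ (F≐G x)

HasDim-resp-≐ : ∀ {n} {F G : PSet n} {d} → F ≐ G → HasDim F d → HasDim G d
HasDim-resp-≐ F≐G ((p , p∈F , ind) , none) =
  (p , (λ j → proj₁ (F≐G (p j)) (p∈F j)) , ind) , (λ p' p'∈G → none p' (λ j → proj₂ (F≐G (p' j)) (p'∈G j)))

IsVertex-resp-≐ : ∀ {n} {F G : PSet n} {x} → F ≐ G → IsVertex F x → IsVertex G x
IsVertex-resp-≐ F≐G (x∈F , a , c , valid , tight , unique) =
  proj₁ (F≐G _) x∈F , a , c , (λ y y∈G → valid y (proj₂ (F≐G y) y∈G)) , tight ,
  (λ y y∈G → unique y (proj₂ (F≐G y) y∈G))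

HasNVertices-resp-≐ : ∀ {n} {F G : PSet n} {N} → F ≐ G → HasNVertices F N → HasNVertices G N
HasNVertices-resp-≐ F≐G (p , vertex , injective , onto) =
  p , (λ j → IsVertex-resp-≐ F≐G (vertex j)) , injective ,
  (λ x v → onto x (IsVertex-resp-≐ (≐-sym F≐G) v))

module _ {n N : ℕ} (q : Fin N → Pt n) where

  SpannedBy : ∀ {M} → (Fin M → Fin N) → (Fin N → Set) → Pt n → Set
  SpannedBy {M} E Extra x = Σ (Fin N → ℚ) λ β → (sumFin β ≡ 1ℚ) ×
    (∀ i → x i ≡ sumFin (λ l → β l * q l i)) × (∀ l → β l ≡ 0ℚ ⊎ Extra l ⊎ ∃ λ r → E r ≡ l)

  NoExtra : Fin N → Set
  NoExtra _ = ⊥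

  preimage? : ∀ {M} (E : Fin M → Fin N) l → (∃ λ r → E r ≡ l) ⊎ (∀ r → E r ≢ l)
  preimage? {zero}  E l = inj₂ (λ ())
  preimage? {suc M} E l with E zero Fin.≟ l | preimage? (λ r → E (suc r)) l
  ... | yes E0≡l | _              = inj₁ (zero , E0≡l)
  ... | no _     | inj₁ (r , Er≡l) = inj₁ (suc r , Er≡l)
  ... | no E0≢l  | inj₂ E'≢l       = inj₂ λ { zero → E0≢l ; (suc r) → E'≢l r }

  -- M+1 points in the affine span of M points are affinely dependent: their M+1 weight vectors,
  -- restricted to the image of E, satisfy a nontrivial linear relation.
  spanned-NoAffInd : ∀ {M} (E : Fin M → Fin N) (S : PSet n) →
    (∀ x → S x → SpannedBy E NoExtra x) → NoAffInd S (suc M)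
  spanned-NoAffInd {M} E S spanned p p∈S ind
    with underdetermined-solvable M (λ r j → proj₁ (spanned (p j) (p∈S j)) (E r))
  ... | μ , (j0 , μj0≢0) , solves = μj0≢0 (ind μ Σμ≡0 comb≡0 j0)
    where
    β : Fin (suc M) → Fin N → ℚ
    β j = proj₁ (spanned (p j) (p∈S j))
    column≡0 : ∀ l → sumFin (λ j → μ j * β j l) ≡ 0ℚ
    column≡0 l with preimage? E l
    ... | inj₁ (r , refl) = trans (sumFin-cong (λ j → *-comm (μ j) (β j (E r)))) (solves r)
    ... | inj₂ E≢l = sumFin-zero μβ≡0
      where μβ≡0 : ∀ j → μ j * β j l ≡ 0ℚ
            μβ≡0 j with proj₂ (proj₂ (proj₂ (spanned (p j) (p∈S j)))) l
            ... | inj₁ βjl≡0             = trans (cong (μ j *_) βjl≡0) (*-zeroʳ (μ j))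
            ... | inj₂ (inj₂ (r , Er≡l)) = ⊥-elim (E≢l r Er≡l)
    Σμ≡0 : sumFin μ ≡ 0ℚ
    Σμ≡0 = begin
      sumFin μ
        ≡⟨ sumFin-cong (λ j → trans (sym (*-identityʳ (μ j))) (cong (μ j *_) (sym (proj₁ (proj₂ (spanned (p j) (p∈S j))))))) ⟩
      sumFin (λ j → μ j * sumFin (β j))
        ≡⟨ sumFin-cong (λ j → sym (sumFin-*ˡ (μ j) (β j))) ⟩
      sumFin (λ j → sumFin (λ l → μ j * β j l))
        ≡⟨ sumFin-comm (λ j l → μ j * β j l) ⟩
      sumFin (λ l → sumFin (λ j → μ j * β j l))
        ≡⟨ sumFin-zero column≡0 ⟩
      0ℚ ∎
      where open ≡-Reasoning
    comb≡0 : ∀ i → sumFin (λ j → μ j * p j i) ≡ 0ℚ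
    comb≡0 i = begin
      sumFin (λ j → μ j * p j i)
        ≡⟨ sumFin-cong (λ j → cong (μ j *_) (proj₁ (proj₂ (proj₂ (spanned (p j) (p∈S j)))) i)) ⟩
      sumFin (λ j → μ j * sumFin (λ l → β j l * q l i))
        ≡⟨ sumFin-cong (λ j → sym (sumFin-*ˡ (μ j) (λ l → β j l * q l i))) ⟩
      sumFin (λ j → sumFin (λ l → μ j * (β j l * q l i)))
        ≡⟨ sumFin-comm (λ j l → μ j * (β j l * q l i)) ⟩
      sumFin (λ l → sumFin (λ j → μ j * (β j l * q l i)))
        ≡⟨ sumFin-cong (λ l → trans (sumFin-cong (λ j → sym (*-assoc (μ j) (β j l) (q l i)))) (sumFin-*ʳ (q l i) (λ j → μ j * β j l))) ⟩
      sumFin (λ l → sumFin (λ j → μ j * β j l) * q l i)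
        ≡⟨ sumFin-zero (λ l → trans (cong (_* q l i) (column≡0 l)) (*-zeroˡ (q l i))) ⟩
      0ℚ ∎
      where open ≡-Reasoning

  -- An affine dependence ρ involving q l0 lets every weight on l0 be traded for weights on E.
  spanned-modulo-dependence-NoAffInd : ∀ {M} (E : Fin M → Fin N) l0 (ρ : Fin N → ℚ) →
    ρ l0 ≢ 0ℚ → sumFin ρ ≡ 0ℚ → (∀ i → sumFin (λ l → ρ l * q l i) ≡ 0ℚ) →
    (∀ l → ρ l ≡ 0ℚ ⊎ l ≡ l0 ⊎ ∃ λ r → E r ≡ l) →
    (S : PSet n) → (∀ x → S x → SpannedBy E (_≡ l0) x) → NoAffInd S (suc M)
  spanned-modulo-dependence-NoAffInd E l0 ρ ρl0≢0 Σρ≡0 Σρq≡0 ρ-support S spanned =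
    spanned-NoAffInd E S eliminate
    where
    instance _ = ≢-nonZero ρl0≢0
    eliminate : ∀ x → S x → SpannedBy E NoExtra x
    eliminate x x∈S = β' , Σβ'≡1 , x≡ , support
      where
      β = proj₁ (spanned x x∈S)
      t = β l0 * (1/ ρ l0)
      β' : Fin N → ℚ
      β' l = β l - t * ρ l
      Σβ'≡1 : sumFin β' ≡ 1ℚ
      Σβ'≡1 = begin
        sumFin β'
          ≡⟨ sumFin-- β (λ l → t * ρ l) ⟩
        sumFin β - sumFin (λ l → t * ρ l)
          ≡⟨ cong₂ _-_ (proj₁ (proj₂ (spanned x x∈S))) (trans (sumFin-*ˡ t ρ) (trans (cong (t *_) Σρ≡0) (*-zeroʳ t))) ⟩
        1ℚ - 0ℚ
          ≡⟨ +-identityʳ 1ℚ ⟩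
        1ℚ ∎
        where open ≡-Reasoning
      x≡ : ∀ i → x i ≡ sumFin (λ l → β' l * q l i)
      x≡ i = sym (begin
        sumFin (λ l → β' l * q l i)
          ≡⟨ sumFin-cong (λ l → regroup (β l) t (ρ l) (q l i)) ⟩
        sumFin (λ l → β l * q l i - t * (ρ l * q l i))
          ≡⟨ sumFin-- (λ l → β l * q l i) (λ l → t * (ρ l * q l i)) ⟩
        sumFin (λ l → β l * q l i) - sumFin (λ l → t * (ρ l * q l i))
          ≡⟨ cong₂ _-_ (sym (proj₁ (proj₂ (proj₂ (spanned x x∈S))) i)) (trans (sumFin-*ˡ t (λ l → ρ l * q l i)) (trans (cong (t *_) (Σρq≡0 i)) (*-zeroʳ t))) ⟩
        x i - 0ℚ
          ≡⟨ +-identityʳ (x i) ⟩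
        x i                                                               ∎)
        where open ≡-Reasoning
              regroup : ∀ a b c d → (a - b * c) * d ≡ a * d - b * (c * d)
              regroup = solve 4 (λ a b c d → (a :- b :* c) :* d := a :* d :- b :* (c :* d)) refl
      β'l0≡0 : β' l0 ≡ 0ℚ
      β'l0≡0 = begin
        β l0 - β l0 * (1/ ρ l0) * ρ l0   ≡⟨ cong (λ z → β l0 - z) (*-assoc (β l0) (1/ ρ l0) (ρ l0)) ⟩
        β l0 - β l0 * ((1/ ρ l0) * ρ l0) ≡⟨ cong (λ z → β l0 - β l0 * z) (*-inverseˡ (ρ l0)) ⟩
        β l0 - β l0 * 1ℚ                 ≡⟨ cancel (β l0) ⟩
        0ℚ                               ∎
        where open ≡-Reasoning
              cancel : ∀ a → a - a * 1ℚ ≡ 0ℚ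
              cancel = solve 1 (λ a → a :- a :* con 1ℚ := con 0ℚ) refl
      support : ∀ l → β' l ≡ 0ℚ ⊎ NoExtra l ⊎ ∃ λ r → E r ≡ l
      support l with proj₂ (proj₂ (proj₂ (spanned x x∈S))) l | ρ-support l
      ... | inj₂ (inj₁ refl) | _                = inj₁ β'l0≡0
      ... | inj₂ (inj₂ E∋l)  | _                = inj₂ (inj₂ E∋l)
      ... | inj₁ _           | inj₂ (inj₁ refl) = inj₁ β'l0≡0
      ... | inj₁ _           | inj₂ (inj₂ E∋l)  = inj₂ (inj₂ E∋l)
      ... | inj₁ βl≡0        | inj₁ ρl≡0        = inj₁ (trans (cong₂ (λ a b → a - t * b) βl≡0 ρl≡0) (0-t*0 t))
        where 0-t*0 : ∀ a → 0ℚ - a * 0ℚ ≡ 0ℚ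
              0-t*0 = solve 1 (λ a → con 0ℚ :- a :* con 0ℚ := con 0ℚ) refl

nextS-inject₁ : ∀ {m} (i : Fin m) → nextS (inject₁ i) ≡ suc i
nextS-inject₁ {suc m} zero = refl
nextS-inject₁ {suc (suc m)} (suc i) rewrite nextS-inject₁ i = refl

nextS-fromℕ : ∀ m → nextS (fromℕ m) ≡ zero
nextS-fromℕ zero = refl
nextS-fromℕ (suc m) rewrite nextS-fromℕ m = refl

inject₁⊎fromℕ : ∀ {m} (i : Fin (suc m)) → (∃ λ j → i ≡ inject₁ j) ⊎ i ≡ fromℕ m
inject₁⊎fromℕ {zero}  zero = inj₂ refl
inject₁⊎fromℕ {suc m} zero = inj₁ (zero , refl)
inject₁⊎fromℕ {suc m} (suc i) with inject₁⊎fromℕ i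
... | inj₁ (j , refl) = inj₁ (suc j , refl)
... | inj₂ refl       = inj₂ refl

nextS-injective : ∀ {m} (i j : Fin (suc m)) → nextS i ≡ nextS j → i ≡ j
nextS-injective {m} i j eq with inject₁⊎fromℕ i | inject₁⊎fromℕ j
... | inj₁ (a , refl) | inj₁ (b , refl) =
  cong inject₁ (suc-injective (trans (sym (nextS-inject₁ a)) (trans eq (nextS-inject₁ b))))
... | inj₂ refl | inj₂ refl = refl
... | inj₁ (a , refl) | inj₂ refl with () ← trans (sym (nextS-inject₁ a)) (trans eq (nextS-fromℕ m))
... | inj₂ refl | inj₁ (b , refl) with () ← trans (sym (nextS-inject₁ b)) (trans (sym eq) (nextS-fromℕ m))

NextSView : ∀ {m} → Fin (suc m) → Set
NextSView {m} i = toℕ (nextS i) ≡ suc (toℕ i) ⊎ (nextS i ≡ zero × toℕ i ≡ m)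

toℕ-nextS : ∀ {m} (i : Fin (suc m)) → NextSView i
toℕ-nextS {m} i with inject₁⊎fromℕ i
... | inj₁ (j , refl) = inj₁ (trans (cong toℕ (nextS-inject₁ j)) (cong suc (sym (toℕ-inject₁ j))))
... | inj₂ refl       = inj₂ (nextS-fromℕ m , toℕ-fromℕ m)

nextS-irreflexive : ∀ {m} → 1 ℕ.≤ m → (a : Fin (suc m)) → a ≢ nextS a
nextS-irreflexive (s≤s z≤n) a a≡next = case toℕ-nextS a of λ where
  (inj₁ toℕ-next)             → ℕ.1+n≢n (trans (sym toℕ-next) (cong toℕ (sym a≡next)))
  (inj₂ (next≡0 , toℕa≡last)) → ℕ.1+n≢0 (trans (sym toℕa≡last) (cong toℕ (trans a≡next next≡0)))

-- Needs at least three vertices: on a 2-cycle, going forward twice returns to the start.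
nextS²-irreflexive : ∀ {m} → 2 ℕ.≤ m → (a : Fin (suc m)) → nextS (nextS a) ≢ a
nextS²-irreflexive {suc (suc m)} (s≤s (s≤s z≤n)) a next²≡a = go (toℕ-nextS a) (toℕ-nextS (nextS a))
  where
  go : NextSView a → NextSView (nextS a) → ⊥
  go (inj₂ (next≡0 , toℕa≡last)) _ =
    ℕ.1+n≢0 (ℕ.suc-injective (trans (sym toℕa≡last) (cong toℕ (trans (sym next²≡a) (cong nextS next≡0)))))
  go (inj₁ toℕ-next) (inj₂ (next²≡0 , toℕnext≡last)) =
    ℕ.1+n≢0 (trans (sym (ℕ.suc-injective (trans (sym toℕ-next) toℕnext≡last))) (cong toℕ (trans (sym next²≡a) next²≡0)))
  go (inj₁ toℕ-next) (inj₁ toℕ-next²) =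
    ℕ.m≢1+n+m (toℕ a) (trans (sym (cong toℕ next²≡a)) (trans toℕ-next² (cong suc toℕ-next)))

sumFin-last : ∀ {m} (f : Fin (suc m) → ℚ) → sumFin f ≡ sumFin (λ j → f (inject₁ j)) + f (fromℕ m)
sumFin-last {zero}  f = trans (+-identityʳ (f zero)) (sym (+-identityˡ (f zero)))
sumFin-last {suc m} f =
  trans (cong (f zero +_) (sumFin-last (λ i → f (suc i)))) (sym (+-assoc (f zero) _ _))

sumFin-∘nextS : ∀ {m} (h : Fin (suc m) → ℚ) → sumFin (λ i → h (nextS i)) ≡ sumFin h
sumFin-∘nextS {m} h = begin
  sumFin (λ i → h (nextS i))
    ≡⟨ sumFin-last (λ i → h (nextS i)) ⟩
  sumFin (λ j → h (nextS (inject₁ j))) + h (nextS (fromℕ m))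
    ≡⟨ cong₂ _+_ (sumFin-cong (λ j → cong h (nextS-inject₁ j))) (cong h (nextS-fromℕ m)) ⟩
  sumFin (λ j → h (suc j)) + h zero
    ≡⟨ +-comm _ (h zero) ⟩
  sumFin h ∎
  where open ≡-Reasoning

cyclic-telescope : ∀ {m} (h : Fin (suc m) → ℚ) → sumFin (λ i → h i - h (nextS i)) ≡ 0ℚ
cyclic-telescope h =
  trans (sumFin-- h (λ i → h (nextS i))) (trans (cong (λ z → sumFin h - z) (sumFin-∘nextS h)) (+-inverseʳ (sumFin h)))

nextS-invariant⇒constant : ∀ {m} {X : Set} (h : Fin (suc m) → X) → (∀ a → h a ≡ h (nextS a)) → ∀ u → h u ≡ h zero
nextS-invariant⇒constant h invariant = Fin.<-weakInduction (λ u → h u ≡ h zero) refl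
  (λ i hi≡h0 → trans (trans (cong h (sym (nextS-inject₁ i))) (sym (invariant (inject₁ i)))) hi≡h0)

e-nextS : ∀ {m} (i a : Fin (suc m)) → e (nextS i) (nextS a) ≡ e i a
e-nextS i a = case a Fin.≟ i of λ where
  (yes refl) → trans (e-diagonal (nextS a)) (sym (e-diagonal a))
  (no a≢i)   → trans (e-offDiagonal (nextS i) (nextS a) (λ eq → a≢i (nextS-injective a i eq))) (sym (e-offDiagonal i a a≢i))

Tight : ℚ → ℚ → Set
Tight D c = D ≡ c ⊎ D ≡ - c

sign : Bool → ℚ
sign true  = 1ℚ
sign false = - 1ℚ

sign≢0 : ∀ s → sign s ≢ 0ℚ
sign≢0 true  ()
sign≢0 false ()

sign*sign : ∀ s → sign s * sign s ≡ 1ℚ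
sign*sign true  = refl
sign*sign false = refl

sign*sign-opposite : ∀ s t → s ≢ t → sign s * sign t ≡ - 1ℚ
sign*sign-opposite true  true  s≢t = ⊥-elim (s≢t refl)
sign*sign-opposite true  false _   = refl
sign*sign-opposite false true  _   = refl
sign*sign-opposite false false s≢t = ⊥-elim (s≢t refl)

sign*sign-±1 : ∀ s t → Tight (sign s * sign t) 1ℚ
sign*sign-±1 true  true  = inj₁ refl
sign*sign-±1 true  false = inj₂ refl
sign*sign-±1 false true  = inj₂ refl
sign*sign-±1 false false = inj₁ refl

sumFin-++ : ∀ {p q} (f : Fin (p ℕ.+ q) → ℚ) → sumFin f ≡ sumFin (λ a → f (a ↑ˡ q)) + sumFin (λ a → f (p ↑ʳ a))
sumFin-++ {zero}      f = sym (+-identityˡ _)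
sumFin-++ {suc p} {q} f = trans (cong (f zero +_) (sumFin-++ {p} (λ i → f (suc i)))) (sym (+-assoc (f zero) _ _))

ℕ→ℚ : ℕ → ℚ
ℕ→ℚ zero    = 0ℚ
ℕ→ℚ (suc p) = 1ℚ + ℕ→ℚ p

ℕ→ℚ-nonNeg : ∀ p → 0ℚ ≤ ℕ→ℚ p
ℕ→ℚ-nonNeg zero    = ≤-refl
ℕ→ℚ-nonNeg (suc p) = subst (_≤ 1ℚ + ℕ→ℚ p) (+-identityˡ 0ℚ) (+-mono-≤ 0≤1 (ℕ→ℚ-nonNeg p))

ℕ→ℚ-suc≢0 : ∀ p → ℕ→ℚ (suc p) ≢ 0ℚ
ℕ→ℚ-suc≢0 p eq = <-irrefl (sym eq) (subst (_< 1ℚ + ℕ→ℚ p) (+-identityʳ 0ℚ) (+-mono-<-≤ 0<1 (ℕ→ℚ-nonNeg p)))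

ℕ→ℚ-gap : ∀ P Q → Q ℕ.< P → 1ℚ ≤ ℕ→ℚ P - ℕ→ℚ Q
ℕ→ℚ-gap (suc P) zero    _         = subst₂ _≤_ (+-identityʳ 1ℚ) (sym (+-identityʳ (1ℚ + ℕ→ℚ P))) (+-monoʳ-≤ 1ℚ (ℕ→ℚ-nonNeg P))
ℕ→ℚ-gap (suc P) (suc Q) (s≤s Q<P) = subst (1ℚ ≤_) (shift (ℕ→ℚ P) (ℕ→ℚ Q)) (ℕ→ℚ-gap P Q Q<P)
  where shift : ∀ x y → x - y ≡ 1ℚ + x - (1ℚ + y)
        shift = solve 2 (λ x y → x :- y := con 1ℚ :+ x :- (con 1ℚ :+ y)) refl

ℕ→ℚ-injective : ∀ P Q → ℕ→ℚ P - ℕ→ℚ Q ≡ 0ℚ → P ≡ Q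
ℕ→ℚ-injective P Q eq with ℕ.<-cmp P Q
... | tri≈ _ P≡Q _ = P≡Q
... | tri> _ _ Q<P = ⊥-elim (1≰0 (subst (1ℚ ≤_) eq (ℕ→ℚ-gap P Q Q<P)))
... | tri< P<Q _ _ = ⊥-elim (1≰0 (subst (1ℚ ≤_) (trans (antisym (ℕ→ℚ P) (ℕ→ℚ Q)) (cong -_ eq)) (ℕ→ℚ-gap Q P P<Q)))
  where antisym : ∀ x y → y - x ≡ - (x - y)
        antisym = solve 2 (λ x y → y :- x := :- (x :- y)) refl

sumFin-const : ∀ {k} c → sumFin {k} (λ _ → c) ≡ ℕ→ℚ k * c
sumFin-const {zero}  c = sym (*-zeroˡ c)
sumFin-const {suc k} c = trans (cong (c +_) (sumFin-const {k} c)) (distrib c (ℕ→ℚ k))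
  where distrib : ∀ c x → c + x * c ≡ (1ℚ + x) * c
        distrib = solve 2 (λ c x → c :+ x :* c := (con 1ℚ :+ x) :* c) refl

tight? : ∀ D c → Dec (Tight D c)
tight? D c = (D ≟ c) ⊎-dec (D ≟ - c)

sumFin-± : ∀ {M} (s : Fin M → ℚ) c → (∀ r → Tight (s r) c) →
  ∃ λ P → ∃ λ Q → P ℕ.+ Q ≡ M × sumFin s ≡ c * (ℕ→ℚ P - ℕ→ℚ Q)
sumFin-± {zero}  s c _ = 0 , 0 , refl , sym (trans (cong (c *_) (+-inverseʳ 0ℚ)) (*-zeroʳ c))
sumFin-± {suc M} s c tight with sumFin-± (λ r → s (suc r)) c (λ r → tight (suc r)) | tight zero
... | P , Q , P+Q≡M , Σ≡ | inj₁ s0≡c  =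
  suc P , Q , cong suc P+Q≡M ,
  trans (cong₂ _+_ s0≡c Σ≡) (solve 3 (λ c x y → c :+ c :* (x :- y) := c :* (con 1ℚ :+ x :- y)) refl c (ℕ→ℚ P) (ℕ→ℚ Q))
... | P , Q , P+Q≡M , Σ≡ | inj₂ s0≡-c =
  P , suc Q , trans (ℕ.+-suc P Q) (cong suc P+Q≡M) ,
  trans (cong₂ _+_ s0≡-c Σ≡) (solve 3 (λ c x y → :- c :+ c :* (x :- y) := c :* (x :- (con 1ℚ :+ y))) refl c (ℕ→ℚ P) (ℕ→ℚ Q))

c≤c*y : ∀ {c y} → 0ℚ ≤ c → 1ℚ ≤ y → c ≤ c * y
c≤c*y {c} {y} 0≤c 1≤y = subst (_≤ c * y) (*-identityʳ c) (*-monoˡ-≤ 0≤c 1≤y)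

-- If D is balanced by a nonzero integer multiple of c, then |D| ≥ c; with |D| ≤ c it is tight.
balanced⇒tight : ∀ D c P Q → 0ℚ < c → P ≢ Q → D + c * (ℕ→ℚ P - ℕ→ℚ Q) ≡ 0ℚ →
  - c ≤ D → D ≤ c → Tight D c
balanced⇒tight D c P Q c>0 P≢Q balanced -c≤D D≤c with ℕ.<-cmp P Q
... | tri≈ _ P≡Q _ = ⊥-elim (P≢Q P≡Q)
... | tri> _ _ Q<P = inj₂ (≤-antisym (subst (_≤ - c) (sym D≡) (neg-antimono-≤ (c≤c*y (<⇒≤ c>0) (ℕ→ℚ-gap P Q Q<P)))) -c≤D)
  where D≡ = inverseˡ-unique D (c * (ℕ→ℚ P - ℕ→ℚ Q)) balanced
... | tri< P<Q _ _ = inj₁ (≤-antisym D≤c (subst (c ≤_) (sym D≡) (c≤c*y (<⇒≤ c>0) (ℕ→ℚ-gap Q P P<Q))))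
  where D≡ = trans (inverseˡ-unique D (c * (ℕ→ℚ P - ℕ→ℚ Q)) balanced)
                   (solve 3 (λ c p q → :- (c :* (p :- q)) := c :* (q :- p)) refl c (ℕ→ℚ P) (ℕ→ℚ Q))

toℚ-+ : ∀ x y → toℚ (x ℤ.+ y) ≡ toℚ x + toℚ y
toℚ-+ x y = toℚᵘ-injective
  (ℚᵘ.≃-trans (toℚᵘ-fromℚᵘ (ℚᵘ.mkℚᵘ (x ℤ.+ y) 0))
  (ℚᵘ.≃-trans (ℚᵘ.*≡* (trans (ℤ.*-identityʳ (x ℤ.+ y))
                             (sym (trans (ℤ.*-identityʳ (x ℤ.* ℤ.+ 1 ℤ.+ y ℤ.* ℤ.+ 1))
                                         (cong₂ ℤ._+_ (ℤ.*-identityʳ x) (ℤ.*-identityʳ y))))))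
  (ℚᵘ.≃-trans (ℚᵘ.+-cong (ℚᵘ.≃-sym (toℚᵘ-fromℚᵘ (ℚᵘ.mkℚᵘ x 0))) (ℚᵘ.≃-sym (toℚᵘ-fromℚᵘ (ℚᵘ.mkℚᵘ y 0))))
   (ℚᵘ.≃-sym (toℚᵘ-homo-+ (toℚ x) (toℚ y))))))

toℚ-neg : ∀ x → toℚ (ℤ.- x) ≡ - toℚ x
toℚ-neg x = toℚᵘ-injective
  (ℚᵘ.≃-trans (toℚᵘ-fromℚᵘ (ℚᵘ.mkℚᵘ (ℤ.- x) 0))
  (ℚᵘ.≃-trans (ℚᵘ.-‿cong (ℚᵘ.≃-sym (toℚᵘ-fromℚᵘ (ℚᵘ.mkℚᵘ x 0))))
   (ℚᵘ.≃-sym (toℚᵘ-homo‿- (toℚ x)))))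

toℚ-- : ∀ x y → toℚ (x ℤ.- y) ≡ toℚ x - toℚ y
toℚ-- x y = trans (toℚ-+ x (ℤ.- y)) (cong (λ z → toℚ x + z) (toℚ-neg y))

toℚ-injective : ∀ {x y} → toℚ x ≡ toℚ y → x ≡ y
toℚ-injective {x} {y} eq
  with ℚᵘ.≃-trans (ℚᵘ.≃-sym (toℚᵘ-fromℚᵘ (ℚᵘ.mkℚᵘ x 0))) (ℚᵘ.≃-trans (ℚᵘ.≃-reflexive (cong toℚᵘ eq)) (toℚᵘ-fromℚᵘ (ℚᵘ.mkℚᵘ y 0)))
... | ℚᵘ.*≡* x*1≡y*1 = trans (sym (ℤ.*-identityʳ x)) (trans x*1≡y*1 (ℤ.*-identityʳ y))

signℤ : Bool → ℤ
signℤ true  = ℤ.+ 1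
signℤ false = -[1+ 0 ]

toℚ-signℤ : ∀ s → toℚ (signℤ s) ≡ sign s
toℚ-signℤ true  = refl
toℚ-signℤ false = refl

∣signℤ∣≡1 : ∀ s → ℤ.∣ signℤ s ∣ ≡ 1
∣signℤ∣≡1 true  = refl
∣signℤ∣≡1 false = refl

signℤ-injective : ∀ {s t} → signℤ s ≡ signℤ t → s ≡ t
signℤ-injective {true}  {true}  _ = refl
signℤ-injective {false} {false} _ = refl

∣z∣≡1⇒z≡signℤ : ∀ z → ℤ.∣ z ∣ ≡ 1 → z ≡ signℤ (does (z ℤ.≟ ℤ.+ 1))
∣z∣≡1⇒z≡signℤ (ℤ.+ 1)             _  = refl
∣z∣≡1⇒z≡signℤ -[1+ 0 ]          _  = refl
∣z∣≡1⇒z≡signℤ (ℤ.+ 0)             ()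
∣z∣≡1⇒z≡signℤ (ℤ.+ suc (suc _))   ()
∣z∣≡1⇒z≡signℤ -[1+ suc _ ]      ()

-- prefix s i = -(s 0 + ... + s (i-1)), so consecutive prefix values differ by s i.
prefix : ∀ {k} → (Fin k → ℤ) → Fin (suc k) → ℤ
prefix s zero = ℤ.+ 0
prefix {suc k} s (suc i) = ℤ.- s zero ℤ.+ prefix (λ j → s (suc j)) i

prefix-step : ∀ {k} (s : Fin k → ℤ) i → prefix s (inject₁ i) ℤ.- prefix s (suc i) ≡ s i
prefix-step {suc k} s zero = 0-[-x+0]≡x (s zero)
  where 0-[-x+0]≡x : ∀ x → ℤ.+ 0 ℤ.- (ℤ.- x ℤ.+ ℤ.+ 0) ≡ x
        0-[-x+0]≡x = solve-∀
prefix-step {suc k} s (suc i) =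
  trans ([-x+p]-[-x+q]≡p-q (s zero) (prefix (λ j → s (suc j)) (inject₁ i)) (prefix (λ j → s (suc j)) (suc i)))
        (prefix-step (λ j → s (suc j)) i)
  where [-x+p]-[-x+q]≡p-q : ∀ x p q → (ℤ.- x ℤ.+ p) ℤ.- (ℤ.- x ℤ.+ q) ≡ p ℤ.- q
        [-x+p]-[-x+q]≡p-q = solve-∀

toℚ-prefix-last : ∀ {k} (s : Fin k → ℤ) → toℚ (prefix s (fromℕ k)) ≡ - sumFin (λ i → toℚ (s i))
toℚ-prefix-last {zero}  s = refl
toℚ-prefix-last {suc k} s = begin
  toℚ (ℤ.- s zero ℤ.+ prefix (λ j → s (suc j)) (fromℕ k))
    ≡⟨ toℚ-+ (ℤ.- s zero) (prefix (λ j → s (suc j)) (fromℕ k)) ⟩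
  toℚ (ℤ.- s zero) + toℚ (prefix (λ j → s (suc j)) (fromℕ k))
    ≡⟨ cong₂ _+_ (toℚ-neg (s zero)) (toℚ-prefix-last (λ j → s (suc j))) ⟩
  - toℚ (s zero) + - sumFin (λ i → toℚ (s (suc i)))
    ≡⟨ sym (neg-distrib-+ (toℚ (s zero)) (sumFin (λ i → toℚ (s (suc i))))) ⟩
  - sumFin (λ i → toℚ (s i)) ∎
  where open ≡-Reasoning

trues : ∀ {n} → (Fin n → Bool) → ℕ
trues {zero}  σ = 0
trues {suc n} σ = (if σ zero then 1 else 0) ℕ.+ trues (λ i → σ (suc i))

falses : ∀ {n} → (Fin n → Bool) → ℕ
falses {zero}  σ = 0
falses {suc n} σ = (if σ zero then 0 else 1) ℕ.+ falses (λ i → σ (suc i))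

trues+falses : ∀ {n} (σ : Fin n → Bool) → trues σ ℕ.+ falses σ ≡ n
trues+falses {zero}  σ = refl
trues+falses {suc n} σ with σ zero
... | true  = cong suc (trues+falses (λ i → σ (suc i)))
... | false = trans (ℕ.+-suc (trues (λ i → σ (suc i))) _) (cong suc (trues+falses (λ i → σ (suc i))))

sumFin-sign : ∀ {n} (σ : Fin n → Bool) → sumFin (λ a → sign (σ a)) ≡ ℕ→ℚ (trues σ) - ℕ→ℚ (falses σ)
sumFin-sign {zero}  σ = sym (+-inverseʳ 0ℚ)
sumFin-sign {suc n} σ = trans (cong (sign (σ zero) +_) (sumFin-sign (λ i → σ (suc i)))) (step (σ zero))
  where
  step : ∀ b → sign b + (ℕ→ℚ (trues (λ i → σ (suc i))) - ℕ→ℚ (falses (λ i → σ (suc i))))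
             ≡ ℕ→ℚ ((if b then 1 else 0) ℕ.+ trues (λ i → σ (suc i))) - ℕ→ℚ ((if b then 0 else 1) ℕ.+ falses (λ i → σ (suc i)))
  step true  = solve 2 (λ x y → con 1ℚ :+ (x :- y) := con 1ℚ :+ x :- y) refl
                 (ℕ→ℚ (trues (λ i → σ (suc i)))) (ℕ→ℚ (falses (λ i → σ (suc i))))
  step false = solve 2 (λ x y → :- con 1ℚ :+ (x :- y) := x :- (con 1ℚ :+ y)) refl
                 (ℕ→ℚ (trues (λ i → σ (suc i)))) (ℕ→ℚ (falses (λ i → σ (suc i))))

m+m≡n+n⇒m≡n : ∀ {m n} → m ℕ.+ m ≡ n ℕ.+ n → m ≡ n
m+m≡n+n⇒m≡n {m} {n} eq with ℕ.<-cmp m n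
... | tri≈ _ m≡n _ = m≡n
... | tri< m<n _ _ = ⊥-elim (ℕ.<-irrefl eq (ℕ.+-mono-< m<n m<n))
... | tri> _ _ n<m = ⊥-elim (ℕ.<-irrefl (sym eq) (ℕ.+-mono-< n<m n<m))

1+m+m≢n+n : ∀ m n → suc (m ℕ.+ m) ≢ n ℕ.+ n
1+m+m≢n+n m       zero    ()
1+m+m≢n+n zero    (suc n) eq with () ← trans eq (cong suc (ℕ.+-suc n n))
1+m+m≢n+n (suc m) (suc n) eq = 1+m+m≢n+n m n
  (ℕ.suc-injective (ℕ.suc-injective (trans (sym (cong (λ z → suc (suc z)) (ℕ.+-suc m m))) (trans eq (cong suc (ℕ.+-suc n n))))))

balanced⇒trues≡half : ∀ {n k} (σ : Fin n → Bool) → n ≡ k ℕ.+ k → sumFin (λ a → sign (σ a)) ≡ 0ℚ → trues σ ≡ k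
balanced⇒trues≡half σ n≡ Σ≡0 = m+m≡n+n⇒m≡n (trans (cong (trues σ ℕ.+_) t≡f) (trans (trues+falses σ) n≡))
  where t≡f = ℕ→ℚ-injective (trues σ) (falses σ) (trans (sym (sumFin-sign σ)) Σ≡0)

trues≡half⇒balanced : ∀ {n k} (σ : Fin n → Bool) → n ≡ k ℕ.+ k → trues σ ≡ k → sumFin (λ a → sign (σ a)) ≡ 0ℚ
trues≡half⇒balanced {k = k} σ n≡ t≡k = begin
  sumFin (λ a → sign (σ a))          ≡⟨ sumFin-sign σ ⟩
  ℕ→ℚ (trues σ) - ℕ→ℚ (falses σ)    ≡⟨ cong₂ (λ t f → ℕ→ℚ t - ℕ→ℚ f) t≡k f≡k ⟩
  ℕ→ℚ k - ℕ→ℚ k                     ≡⟨ +-inverseʳ (ℕ→ℚ k) ⟩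
  0ℚ                                 ∎
  where open ≡-Reasoning
        f≡k = ℕ.+-cancelˡ-≡ k (falses σ) k (trans (cong (ℕ._+ falses σ) (sym t≡k)) (trans (trues+falses σ) n≡))

pascal : ∀ n k → n C k ℕ.+ n C suc k ≡ suc n C suc k
pascal = nCk+nC[k+1]≡[n+1]C[k+1]

toPascal : ∀ n k → Fin (suc n C suc k) → Fin (n C k) ⊎ Fin (n C suc k)
toPascal n k j = splitAt (n C k) (cast (sym (pascal n k)) j)

fromPascal : ∀ n k → Fin (n C k) ⊎ Fin (n C suc k) → Fin (suc n C suc k)
fromPascal n k x = cast (pascal n k) (join (n C k) (n C suc k) x)

toPascal-fromPascal : ∀ n k x → toPascal n k (fromPascal n k x) ≡ x
toPascal-fromPascal n k x =
  trans (cong (splitAt (n C k)) (cast-involutive (sym (pascal n k)) (pascal n k) _)) (splitAt-join (n C k) (n C suc k) x)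

fromPascal-toPascal : ∀ n k j → fromPascal n k (toPascal n k j) ≡ j
fromPascal-toPascal n k j =
  trans (cong (cast (pascal n k)) (join-splitAt (n C k) (n C suc k) _)) (cast-involutive (pascal n k) (sym (pascal n k)) j)

-- The sign vectors with exactly k entries true, listed by Pascal's rule on the first entry.
ofSize : ∀ n k → Fin (n C k) → Fin n → Bool
ofSize-split : ∀ n k → Fin (n C k) ⊎ Fin (n C suc k) → Fin (suc n) → Bool
ofSize zero    zero    j ()
ofSize zero    (suc k) ()
ofSize (suc n) zero    j i = false
ofSize (suc n) (suc k) j = ofSize-split n k (toPascal n k j)
ofSize-split n k (inj₁ j) = true  ∷ ofSize n k j
ofSize-split n k (inj₂ j) = false ∷ ofSize n (suc k) j

trues-ofSize : ∀ n k j → trues (ofSize n k j) ≡ k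
trues-ofSize zero    zero    j = refl
trues-ofSize (suc n) zero    j = trues-false n
  where trues-false : ∀ n → trues {suc n} (λ _ → false) ≡ 0
        trues-false zero    = refl
        trues-false (suc n) = trues-false n
trues-ofSize (suc n) (suc k) j with toPascal n k j
... | inj₁ j' = cong suc (trues-ofSize n k j')
... | inj₂ j' = trues-ofSize n (suc k) j'

ofSize-injective : ∀ n k j j' → (∀ i → ofSize n k j i ≡ ofSize n k j' i) → j ≡ j'
ofSize-injective zero    zero    zero zero _ = refl
ofSize-injective (suc n) zero    zero zero _ = refl
ofSize-injective (suc n) (suc k) j j' same =
  trans (sym (fromPascal-toPascal n k j))
        (trans (cong (fromPascal n k) (split-injective (toPascal n k j) (toPascal n k j') same)) (fromPascal-toPascal n k j'))
  where
  split-injective : ∀ x y → (∀ i → ofSize-split n k x i ≡ ofSize-split n k y i) → x ≡ y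
  split-injective (inj₁ x) (inj₁ y) same = cong inj₁ (ofSize-injective n k x y (λ i → same (suc i)))
  split-injective (inj₂ x) (inj₂ y) same = cong inj₂ (ofSize-injective n (suc k) x y (λ i → same (suc i)))
  split-injective (inj₁ x) (inj₂ y) same with () ← same zero
  split-injective (inj₂ x) (inj₁ y) same with () ← same zero

trues≡0⇒false : ∀ {n} (σ : Fin n → Bool) → trues σ ≡ 0 → ∀ i → σ i ≡ false
trues≡0⇒false {suc n} σ t≡0 = from-head (σ zero) refl t≡0
  where
  from-head : ∀ b → σ zero ≡ b → (if b then 1 else 0) ℕ.+ trues (λ i → σ (suc i)) ≡ 0 → ∀ i → σ i ≡ false
  from-head false σ0≡ t≡0 zero    = σ0≡
  from-head false σ0≡ t≡0 (suc i) = trues≡0⇒false (λ i → σ (suc i)) t≡0 i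

ofSize-surjective : ∀ n k (σ : Fin n → Bool) → trues σ ≡ k → ∃ λ j → ∀ i → ofSize n k j i ≡ σ i
ofSize-surjective zero    zero σ _ = zero , λ ()
ofSize-surjective (suc n) k    σ t≡k = from-head (σ zero) k refl t≡k
  where
  tail : Fin n → Bool
  tail i = σ (suc i)
  ofSize-fromPascal : ∀ {k} x i → ofSize (suc n) (suc k) (fromPascal n k x) i ≡ ofSize-split n k x i
  ofSize-fromPascal {k} x i = cong (λ y → ofSize-split n k y i) (toPascal-fromPascal n k x)
  from-head : ∀ b k → σ zero ≡ b → (if b then 1 else 0) ℕ.+ trues tail ≡ k → ∃ λ j → ∀ i → ofSize (suc n) k j i ≡ σ i
  from-head true (suc k) σ0≡ t≡k with ofSize-surjective n k tail (ℕ.suc-injective t≡k)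
  ... | j , same = fromPascal n k (inj₁ j) , λ where
    zero    → trans (ofSize-fromPascal {k} (inj₁ j) zero) (sym σ0≡)
    (suc i) → trans (ofSize-fromPascal {k} (inj₁ j) (suc i)) (same i)
  from-head false (suc k) σ0≡ t≡k with ofSize-surjective n (suc k) tail t≡k
  ... | j , same = fromPascal n k (inj₂ j) , λ where
    zero    → trans (ofSize-fromPascal {k} (inj₂ j) zero) (sym σ0≡)
    (suc i) → trans (ofSize-fromPascal {k} (inj₂ j) (suc i)) (same i)
  from-head false zero σ0≡ t≡0 = zero , λ i → sym (trues≡0⇒false σ (trans (cong (λ b → (if b then 1 else 0) ℕ.+ trues tail) σ0≡) t≡0) i)

module Labelings (m : ℕ) where

  n : ℕ
  n = suc m

  Δ : (Fin n → ℤ) → Fin n → ℤ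
  Δ f a = f a ℤ.- f (nextS a)

  signsOf : (Fin n → ℤ) → Fin n → Bool
  signsOf f a = does (Δ f a ℤ.≟ ℤ.+ 1)

  Admissible⇒Δ≡signℤ : ∀ v0 f → Admissible v0 f → ∀ a → Δ f a ≡ signℤ (signsOf f a)
  Admissible⇒Δ≡signℤ v0 f (_ , ∣Δ∣≡1) a = ∣z∣≡1⇒z≡signℤ (Δ f a) (∣Δ∣≡1 a)

  toℚ-Δ : ∀ (f : Fin n → ℤ) (σ : Fin n → Bool) → (∀ a → Δ f a ≡ signℤ (σ a)) → ∀ a → toℚ (f a) - toℚ (f (nextS a)) ≡ sign (σ a)
  toℚ-Δ f σ Δ≡ a = trans (sym (toℚ-- (f a) (f (nextS a)))) (trans (cong toℚ (Δ≡ a)) (toℚ-signℤ (σ a)))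

  Δ-injective : ∀ {v0} (f g : Fin n → ℤ) → f v0 ≡ g v0 → (∀ a → Δ f a ≡ Δ g a) → ∀ u → f u ≡ g u
  Δ-injective {v0} f g f≡g Δf≡Δg u =
    ℤ.i-j≡0⇒i≡j (f u) (g u) (trans (constant u) (trans (sym (constant v0)) (ℤ.i≡j⇒i-j≡0 f≡g)))
    where
    h : Fin n → ℤ
    h u = f u ℤ.- g u
    regroup : ∀ a b c d → (a ℤ.- b) ℤ.- (c ℤ.- d) ≡ (a ℤ.- c) ℤ.- (b ℤ.- d)
    regroup = solve-∀
    constant : ∀ u → h u ≡ h zero
    constant = nextS-invariant⇒constant h λ a → ℤ.i-j≡0⇒i≡j (h a) (h (nextS a))
      (trans (regroup (f a) (g a) (f (nextS a)) (g (nextS a))) (ℤ.i≡j⇒i-j≡0 (Δf≡Δg a)))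

  -- Integrate the signs around the cycle; balance makes the walk close up.
  module FromSigns (σ : Fin n → Bool) (balanced : sumFin (λ a → sign (σ a)) ≡ 0ℚ) (v0 : Fin n) where

    walk : Fin n → ℤ
    walk = prefix (λ i → signℤ (σ (inject₁ i)))

    walk-closes : toℚ (walk (fromℕ m)) ≡ toℚ (signℤ (σ (fromℕ m)))
    walk-closes = begin
      toℚ (walk (fromℕ m))
        ≡⟨ toℚ-prefix-last (λ i → signℤ (σ (inject₁ i))) ⟩
      - sumFin (λ i → toℚ (signℤ (σ (inject₁ i))))
        ≡⟨ cong -_ (sumFin-cong (λ i → toℚ-signℤ (σ (inject₁ i)))) ⟩
      - sumFin (λ i → sign (σ (inject₁ i)))
        ≡⟨ sym (inverseʳ-unique (sumFin (λ i → sign (σ (inject₁ i)))) (sign (σ (fromℕ m)))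
                                (trans (sym (sumFin-last (λ a → sign (σ a)))) balanced)) ⟩
      sign (σ (fromℕ m))
        ≡⟨ sym (toℚ-signℤ (σ (fromℕ m))) ⟩
      toℚ (signℤ (σ (fromℕ m))) ∎
      where open ≡-Reasoning

    Δ-walk : ∀ a → Δ walk a ≡ signℤ (σ a)
    Δ-walk a = case inject₁⊎fromℕ a of λ where
      (inj₁ (i , refl)) → trans (cong (λ z → walk (inject₁ i) ℤ.- walk z) (nextS-inject₁ i))
                                (prefix-step (λ i → signℤ (σ (inject₁ i))) i)
      (inj₂ refl)       → trans (cong (λ z → walk (fromℕ m) ℤ.- walk z) (nextS-fromℕ m))
                                (trans (ℤ.+-identityʳ (walk (fromℕ m))) (toℚ-injective walk-closes))

    labeling : Fin n → ℤ
    labeling u = walk u ℤ.- walk v0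

    Δ-labeling : ∀ a → Δ labeling a ≡ signℤ (σ a)
    Δ-labeling a = trans (cancel (walk a) (walk (nextS a)) (walk v0)) (Δ-walk a)
      where cancel : ∀ x y z → (x ℤ.- z) ℤ.- (y ℤ.- z) ≡ x ℤ.- y
            cancel = solve-∀

    labeling-Admissible : Admissible v0 labeling
    labeling-Admissible = ℤ.+-inverseʳ (walk v0) , λ a → trans (cong ℤ.∣_∣ (Δ-labeling a)) (∣signℤ∣≡1 (σ a))

module Cycle (m : ℕ) where

  n : ℕ
  n = suc m

  P : PSet n
  P = SEP (cycleEdges n)

  gen : Fin (n ℕ.+ n) → Pt n
  gen = sepGens (cycleEdges n)

  -- gen (genIdx a true) = e_a - e_(a+1) and gen (genIdx a false) = e_(a+1) - e_a.
  genIdx : Fin n → Bool → Fin (n ℕ.+ n)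
  genIdx a true  = a ↑ˡ n
  genIdx a false = n ↑ʳ a

  edgeVec : Fin n → Pt n
  edgeVec a u = e a u - e (nextS a) u

  gen-genIdx : ∀ a s u → gen (genIdx a s) u ≡ sign s * edgeVec a u
  gen-genIdx a true  u rewrite splitAt-↑ˡ n a n = sym (*-identityˡ _)
  gen-genIdx a false u rewrite splitAt-↑ʳ n n a = flip (e a u) (e (nextS a) u)
    where flip : ∀ x y → y - x ≡ (- 1ℚ) * (x - y)
          flip = solve 2 (λ x y → y :- x := (:- con 1ℚ) :* (x :- y)) refl

  genIdx-surjective : ∀ l → ∃ λ a → Σ Bool λ s → l ≡ genIdx a s
  genIdx-surjective l with splitAt n l in eq
  ... | inj₁ a = a , true  , sym (splitAt⁻¹-↑ˡ eq)
  ... | inj₂ a = a , false , sym (splitAt⁻¹-↑ʳ eq)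

  genIdx-elim : (Q : Fin (n ℕ.+ n) → Set) → (∀ a s → Q (genIdx a s)) → ∀ l → Q l
  genIdx-elim Q q l with genIdx-surjective l
  ... | a , s , refl = q a s

  splitAt-genIdx : ∀ a s → splitAt n (genIdx a s) ≡ (if s then inj₁ a else inj₂ a)
  splitAt-genIdx a true  = splitAt-↑ˡ n a n
  splitAt-genIdx a false = splitAt-↑ʳ n n a

  genIdx-injective : ∀ {a a' s s'} → genIdx a s ≡ genIdx a' s' → a ≡ a' × s ≡ s'
  genIdx-injective {a} {a'} {s} {s'} eq =
    inj-split s s' (trans (sym (splitAt-genIdx a s)) (trans (cong (splitAt n) eq) (splitAt-genIdx a' s')))
    where inj-split : ∀ s s' → (if s then inj₁ a else inj₂ a) ≡ (if s' then inj₁ a' else inj₂ a') → a ≡ a' × s ≡ s'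
          inj-split true  true  refl = refl , refl
          inj-split false false refl = refl , refl

  sumFin-genIdx : ∀ (f : Fin (n ℕ.+ n) → ℚ) → sumFin f ≡ sumFin (λ a → f (genIdx a true) + f (genIdx a false))
  sumFin-genIdx f = trans (sumFin-++ {n} {n} f) (sym (sumFin-+ (λ a → f (genIdx a true)) (λ a → f (genIdx a false))))

  dot-edgeVec : ∀ (b : Pt n) a → dot b (edgeVec a) ≡ b a - b (nextS a)
  dot-edgeVec b a = begin
    sumFin (λ u → b u * (e a u - e (nextS a) u))
      ≡⟨ sumFin-cong (λ u → *-distribˡ-+ (b u) (e a u) (- e (nextS a) u)) ⟩
    sumFin (λ u → b u * e a u + b u * (- e (nextS a) u))
      ≡⟨ sumFin-+ (λ u → b u * e a u) (λ u → b u * (- e (nextS a) u)) ⟩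
    sumFin (λ u → b u * e a u) + sumFin (λ u → b u * (- e (nextS a) u))
      ≡⟨ cong (sumFin (λ u → b u * e a u) +_) (sumFin-cong (λ u → sym (neg-distribʳ-* (b u) (e (nextS a) u)))) ⟩
    sumFin (λ u → b u * e a u) + sumFin (λ u → - (b u * e (nextS a) u))
      ≡⟨ cong₂ _+_ (sumFin-*e a b) (trans (sumFin-neg (λ u → b u * e (nextS a) u)) (cong -_ (sumFin-*e (nextS a) b))) ⟩
    b a - b (nextS a) ∎
    where open ≡-Reasoning

  dot-gen : ∀ (b : Pt n) a s → dot b (gen (genIdx a s)) ≡ sign s * (b a - b (nextS a))
  dot-gen b a s =
    trans (sumFin-cong (λ u → trans (cong (b u *_) (gen-genIdx a s u)) (x*[y*z]≡y*[x*z] (b u) (sign s) (edgeVec a u))))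
          (trans (sumFin-*ˡ (sign s) (λ u → b u * edgeVec a u)) (cong (sign s *_) (dot-edgeVec b a)))

  dot-gen-all : ∀ (b : Pt n) c → (∀ a s → sign s * (b a - b (nextS a)) ≡ c) → ∀ l → dot b (gen l) ≡ c
  dot-gen-all b c h = genIdx-elim (λ l → dot b (gen l) ≡ c) (λ a s → trans (dot-gen b a s) (h a s))

  edgeVec-relation : ∀ (ν : Fin n → ℚ) → (∀ u → sumFin (λ i → ν i * edgeVec i u) ≡ 0ℚ) → ∀ i → ν i ≡ ν zero
  edgeVec-relation ν relation = nextS-invariant⇒constant ν
    (λ a → sym (p-q≡0⇒p≡q (trans (sym (coordinate a)) (relation (nextS a)))))
    where
    coordinate : ∀ a → sumFin (λ i → ν i * edgeVec i (nextS a)) ≡ ν (nextS a) - ν a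
    coordinate a = begin
      sumFin (λ i → ν i * edgeVec i (nextS a))
        ≡⟨ sumFin-cong (λ i → *-distribˡ-+ (ν i) (e i (nextS a)) (- e (nextS i) (nextS a))) ⟩
      sumFin (λ i → ν i * e i (nextS a) + ν i * (- e (nextS i) (nextS a)))
        ≡⟨ sumFin-+ (λ i → ν i * e i (nextS a)) (λ i → ν i * (- e (nextS i) (nextS a))) ⟩
      sumFin (λ i → ν i * e i (nextS a)) + sumFin (λ i → ν i * (- e (nextS i) (nextS a)))
        ≡⟨ cong₂ _+_ (sumFin-cong (λ i → cong (ν i *_) (e-sym i (nextS a))))
                     (sumFin-cong (λ i → trans (sym (neg-distribʳ-* (ν i) _)) (cong (λ z → - (ν i * z)) (trans (e-nextS i a) (e-sym i a))))) ⟩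
      sumFin (λ i → ν i * e (nextS a) i) + sumFin (λ i → - (ν i * e a i))
        ≡⟨ cong₂ _+_ (sumFin-*e (nextS a) ν) (trans (sumFin-neg (λ i → ν i * e a i)) (cong -_ (sumFin-*e a ν))) ⟩
      ν (nextS a) - ν a ∎
      where open ≡-Reasoning

  forward : Fin n → Pt n
  forward a = gen (genIdx a true)

  forward-AffInd : AffInd forward
  forward-AffInd μ Σμ≡0 comb≡0 j = trans (constant j) (μ0≡0)
    where
    constant : ∀ i → μ i ≡ μ zero
    constant = edgeVec-relation μ (λ u →
      trans (sumFin-cong (λ i → cong (μ i *_) (sym (trans (gen-genIdx i true u) (*-identityˡ (edgeVec i u)))))) (comb≡0 u))
    μ0≡0 : μ zero ≡ 0ℚ
    μ0≡0 = p*q≡0⇒q≡0 (ℕ→ℚ-suc≢0 m) (trans (sym (sumFin-const {n} (μ zero))) (trans (sym (sumFin-cong constant)) Σμ≡0))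

  P-coordinateSum : ∀ x → P x → sumFin x ≡ 0ℚ
  P-coordinateSum x x∈P = begin
    sumFin x
      ≡⟨ sumFin-cong (λ u → sym (*-identityˡ (x u))) ⟩
    dot (λ _ → 1ℚ) x
      ≡⟨ dot-Conv gen (λ _ → 1ℚ) x∈P ⟩
    sumFin (λ l → proj₁ x∈P l * dot (λ _ → 1ℚ) (gen l))
      ≡⟨ sumFin-zero (λ l → trans (cong (proj₁ x∈P l *_) (dot-gen-all (λ _ → 1ℚ) 0ℚ 1-1≡0 l)) (*-zeroʳ (proj₁ x∈P l))) ⟩
    0ℚ ∎
    where open ≡-Reasoning
          1-1≡0 : ∀ a s → sign s * (1ℚ - 1ℚ) ≡ 0ℚ
          1-1≡0 a s = trans (cong (sign s *_) (+-inverseʳ 1ℚ)) (*-zeroʳ (sign s))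

  hyperplaneBasis : Fin n → Pt n
  hyperplaneBasis zero    u = 0ℚ
  hyperplaneBasis (suc l) u = e (suc l) u - e zero u

  coordinateSum≡0⇒spanned : ∀ x → sumFin x ≡ 0ℚ → SpannedBy hyperplaneBasis (λ l → l) (NoExtra hyperplaneBasis) x
  coordinateSum≡0⇒spanned x Σx≡0 = β , Σβ≡1 , x≡ , (λ l → inj₂ (inj₂ (l , refl)))
    where
    rest = sumFin (λ l → x (suc l))
    β : Fin n → ℚ
    β zero    = 1ℚ - rest
    β (suc l) = x (suc l)
    Σβ≡1 : sumFin β ≡ 1ℚ
    Σβ≡1 = solve 2 (λ a b → a :- b :+ b := a) refl 1ℚ rest
    x≡ : ∀ u → x u ≡ sumFin (λ l → β l * hyperplaneBasis l u)
    x≡ zero = begin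
      x zero
        ≡⟨ solve 2 (λ a b → a := a :+ b :- b) refl (x zero) rest ⟩
      x zero + rest - rest
        ≡⟨ cong (_- rest) Σx≡0 ⟩
      0ℚ - rest
        ≡⟨ solve 1 (λ b → con 0ℚ :- b := :- b) refl rest ⟩
      - rest
        ≡⟨ sym (sumFin-neg (λ l → x (suc l))) ⟩
      sumFin (λ l → - x (suc l))
        ≡⟨ sumFin-cong (λ l → solve 1 (λ a → :- a := a :* (con 0ℚ :- con 1ℚ)) refl (x (suc l))) ⟩
      sumFin (λ l → x (suc l) * (0ℚ - 1ℚ))
        ≡⟨ sym (trans (cong (_+ sumFin (λ l → x (suc l) * (0ℚ - 1ℚ))) (*-zeroʳ (β zero))) (+-identityˡ _)) ⟩
      sumFin (λ l → β l * hyperplaneBasis l zero) ∎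
      where open ≡-Reasoning
    x≡ (suc u) = sym (begin
      β zero * 0ℚ + sumFin (λ l → x (suc l) * (e l u - 0ℚ))
        ≡⟨ cong₂ _+_ (*-zeroʳ (β zero)) (sumFin-cong (λ l → cong (x (suc l) *_) (+-identityʳ (e l u)))) ⟩
      0ℚ + sumFin (λ l → x (suc l) * e l u)
        ≡⟨ +-identityˡ _ ⟩
      sumFin (λ l → x (suc l) * e l u)
        ≡⟨ sumFin-cong (λ l → cong (x (suc l) *_) (e-sym l u)) ⟩
      sumFin (λ l → x (suc l) * e u l)
        ≡⟨ sumFin-*e u (λ l → x (suc l)) ⟩
      x (suc u)                                             ∎)
      where open ≡-Reasoning

  P-dim : HasDim P m
  P-dim = (forward , (λ a → Conv-generator gen (genIdx a true)) , forward-AffInd) ,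
          spanned-NoAffInd hyperplaneBasis (λ l → l) P (λ x x∈P → coordinateSum≡0⇒spanned x (P-coordinateSum x x∈P))

module AdmissibleFace (m1 : ℕ) (σ : Fin (suc (suc m1)) → Bool) (b : Pt (suc (suc m1)))
                      (slope : ∀ a → b a - b (nextS a) ≡ sign (σ a)) where

  open Cycle (suc m1)

  Face : PSet n
  Face x = P x × dot b x ≡ 1ℚ

  -- The generator of edge a that b takes to 1; the other one it takes to -1.
  tightIdx : Fin n → Fin (n ℕ.+ n)
  tightIdx a = genIdx a (σ a)

  dot-b-gen : ∀ a s → dot b (gen (genIdx a s)) ≡ sign s * sign (σ a)
  dot-b-gen a s = trans (dot-gen b a s) (cong (sign s *_) (slope a))

  b-valid : ∀ l → dot b (gen l) ≤ 1ℚ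
  b-valid l with genIdx-surjective l
  ... | a , s , refl with s Data.Bool.≟ σ a
  ...   | yes refl = ≤-reflexive (trans (dot-b-gen a s) (sign*sign s))
  ...   | no s≢σa  = subst (_≤ 1ℚ) (sym (trans (dot-b-gen a s) (sign*sign-opposite s (σ a) s≢σa))) -1≤1

  b-tight⇒sign : ∀ a s → dot b (gen (genIdx a s)) ≡ 1ℚ → s ≡ σ a
  b-tight⇒sign a s tight with s Data.Bool.≟ σ a
  ... | yes s≡σa = s≡σa
  ... | no s≢σa  = ⊥-elim (-1≢1 (trans (sym (trans (dot-b-gen a s) (sign*sign-opposite s (σ a) s≢σa))) tight))
    where -1≢1 : - 1ℚ ≢ 1ℚ
          -1≢1 ()

  Face-tight : ∀ a → Face (gen (tightIdx a))
  Face-tight a = Conv-generator gen (tightIdx a) , trans (dot-b-gen a (σ a)) (sign*sign (σ a))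

  Face-support : ∀ x (x∈F : Face x) l → proj₁ (proj₁ x∈F) l ≡ 0ℚ ⊎ ∃ λ a → l ≡ tightIdx a
  Face-support x (x∈P , bx≡1) l = Data.Sum.map₂ tight⇒tightIdx (Conv-tight gen b 1ℚ b-valid x x∈P bx≡1 l)
    where tight⇒tightIdx : dot b (gen l) ≡ 1ℚ → ∃ λ a → l ≡ tightIdx a
          tight⇒tightIdx tight with genIdx-surjective l
          ... | a , s , refl = a , cong (genIdx a) (b-tight⇒sign a s tight)

  otherTight : Fin (suc m1) → Fin (n ℕ.+ n)
  otherTight r = tightIdx (suc r)

  Face-AffInd : AffInd (λ r → gen (otherTight r))
  Face-AffInd μ _ comb≡0 r = p*q≡0⇒p≡0 (sign≢0 (σ (suc r))) (edgeVec-relation ν relation (suc r))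
    where
    ν : Fin n → ℚ
    ν zero    = 0ℚ
    ν (suc r) = μ r * sign (σ (suc r))
    relation : ∀ u → sumFin (λ i → ν i * edgeVec i u) ≡ 0ℚ
    relation u = begin
      0ℚ * edgeVec zero u + sumFin (λ r → μ r * sign (σ (suc r)) * edgeVec (suc r) u)
        ≡⟨ cong₂ _+_ (*-zeroˡ (edgeVec zero u)) (sumFin-cong (λ r → trans (*-assoc (μ r) (sign (σ (suc r))) (edgeVec (suc r) u))
                                                                        (cong (μ r *_) (sym (gen-genIdx (suc r) (σ (suc r)) u))))) ⟩
      0ℚ + sumFin (λ r → μ r * gen (tightIdx (suc r)) u)
        ≡⟨ +-identityˡ (sumFin (λ r → μ r * gen (tightIdx (suc r)) u)) ⟩
      sumFin (λ r → μ r * gen (tightIdx (suc r)) u)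
        ≡⟨ comb≡0 u ⟩
      0ℚ ∎
      where open ≡-Reasoning

  -- Weights of the dependence Σₐ sign(σ a) · gen (tightIdx a) = Σₐ edgeVec a = 0.
  tightWeight : Bool → Bool → ℚ
  tightWeight true  true  = 1ℚ
  tightWeight false false = - 1ℚ
  tightWeight _     _     = 0ℚ

  ρ : Fin (n ℕ.+ n) → ℚ
  ρ l = Data.Sum.[ (λ a → tightWeight true (σ a)) , (λ a → tightWeight false (σ a)) ] (splitAt n l)

  ρ-genIdx : ∀ a s → ρ (genIdx a s) ≡ tightWeight s (σ a)
  ρ-genIdx a true  = cong Data.Sum.[ _ , _ ] (splitAt-genIdx a true)
  ρ-genIdx a false = cong Data.Sum.[ _ , _ ] (splitAt-genIdx a false)

  ρ-tight : ρ (tightIdx zero) ≢ 0ℚ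
  ρ-tight ρ≡0 = sign≢0 (σ zero) (trans (sym (trans (ρ-genIdx zero (σ zero)) (diagonal (σ zero)))) ρ≡0)
    where diagonal : ∀ t → tightWeight t t ≡ sign t
          diagonal true  = refl
          diagonal false = refl

  ρ-sum : sumFin ρ ≡ 0ℚ
  ρ-sum = begin
    sumFin ρ
      ≡⟨ sumFin-genIdx ρ ⟩
    sumFin (λ a → ρ (genIdx a true) + ρ (genIdx a false))
      ≡⟨ sumFin-cong (λ a → trans (cong₂ _+_ (ρ-genIdx a true) (ρ-genIdx a false)) (trans (both (σ a)) (sym (slope a)))) ⟩
    sumFin (λ a → b a - b (nextS a))
      ≡⟨ cyclic-telescope b ⟩
    0ℚ ∎
    where open ≡-Reasoning
          both : ∀ t → tightWeight true t + tightWeight false t ≡ sign t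
          both true  = refl
          both false = refl

  ρ-combination : ∀ u → sumFin (λ l → ρ l * gen l u) ≡ 0ℚ
  ρ-combination u = begin
    sumFin (λ l → ρ l * gen l u)
      ≡⟨ sumFin-genIdx (λ l → ρ l * gen l u) ⟩
    sumFin (λ a → ρ (genIdx a true) * gen (genIdx a true) u + ρ (genIdx a false) * gen (genIdx a false) u)
      ≡⟨ sumFin-cong (λ a → trans (cong₂ _+_ (cong₂ _*_ (ρ-genIdx a true) (gen-genIdx a true u))
                                             (cong₂ _*_ (ρ-genIdx a false) (gen-genIdx a false u)))
                                  (both (σ a) (edgeVec a u))) ⟩
    sumFin (λ a → e a u - e (nextS a) u)
      ≡⟨ cyclic-telescope (λ a → e a u) ⟩
    0ℚ ∎
    where open ≡-Reasoning
          both : ∀ t h → tightWeight true t * (sign true * h) + tightWeight false t * (sign false * h) ≡ h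
          both true  = solve 1 (λ h → con 1ℚ :* (con 1ℚ :* h) :+ con 0ℚ :* (:- con 1ℚ :* h) := h) refl
          both false = solve 1 (λ h → con 0ℚ :* (con 1ℚ :* h) :+ (:- con 1ℚ) :* (:- con 1ℚ :* h) := h) refl

  tight-split : ∀ {l} a → l ≡ tightIdx a → l ≡ tightIdx zero ⊎ ∃ λ r → otherTight r ≡ l
  tight-split zero    l≡ = inj₁ l≡
  tight-split (suc r) l≡ = inj₂ (r , sym l≡)

  ρ-support : ∀ l → ρ l ≡ 0ℚ ⊎ l ≡ tightIdx zero ⊎ ∃ λ r → otherTight r ≡ l
  ρ-support = genIdx-elim (λ l → ρ l ≡ 0ℚ ⊎ l ≡ tightIdx zero ⊎ ∃ λ r → otherTight r ≡ l) λ a s →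
    case s Data.Bool.≟ σ a of λ where
      (yes refl) → inj₂ (tight-split a refl)
      (no s≢σa)  → inj₁ (trans (ρ-genIdx a s) (offDiagonal s (σ a) s≢σa))
    where offDiagonal : ∀ s t → s ≢ t → tightWeight s t ≡ 0ℚ
          offDiagonal true  false _ = refl
          offDiagonal false true  _ = refl
          offDiagonal true  true  s≢t = ⊥-elim (s≢t refl)
          offDiagonal false false s≢t = ⊥-elim (s≢t refl)

  Face-spanned : ∀ x → Face x → SpannedBy gen otherTight (_≡ tightIdx zero) x
  Face-spanned x x∈F@((λs , _ , Σλ≡1 , x≡) , _) = λs , Σλ≡1 , x≡ , support
    where support : ∀ l → λs l ≡ 0ℚ ⊎ l ≡ tightIdx zero ⊎ ∃ λ r → otherTight r ≡ l
          support l = Data.Sum.map₂ (uncurry tight-split) (Face-support x x∈F l)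

  Face-dim : HasDim Face m1
  Face-dim = ((λ r → gen (otherTight r)) , (λ r → Face-tight (suc r)) , Face-AffInd) ,
             spanned-modulo-dependence-NoAffInd gen otherTight (tightIdx zero) ρ ρ-tight ρ-sum ρ-combination ρ-support
               Face Face-spanned

module CycleGram (m : ℕ) (2≤m : 2 ℕ.≤ m) where

  open Cycle m

  two : ℚ
  two = 1ℚ + 1ℚ

  1≤m : 1 ℕ.≤ m
  1≤m = ℕ.≤-trans (s≤s z≤n) 2≤m

  edgeVec-jump : Fin n → Fin n → ℚ
  edgeVec-jump a a' = edgeVec a a' - edgeVec a (nextS a')

  gram : ∀ a s a' s' → dot (gen (genIdx a s)) (gen (genIdx a' s')) ≡ sign s' * sign s * edgeVec-jump a a'
  gram a s a' s' =
    trans (dot-gen (gen (genIdx a s)) a' s')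
          (trans (cong₂ (λ x y → sign s' * (x - y)) (gen-genIdx a s a') (gen-genIdx a s (nextS a')))
                 (factor (sign s') (sign s) (edgeVec a a') (edgeVec a (nextS a'))))
    where factor : ∀ k t x y → k * (t * x - t * y) ≡ k * t * (x - y)
          factor = solve 4 (λ k t x y → k :* (t :* x :- t :* y) := k :* t :* (x :- y)) refl

  edgeVec-jump-self : ∀ a → edgeVec-jump a a ≡ two
  edgeVec-jump-self a = trans
    (cong₂ (λ x y → (e a a - x) - (y - e (nextS a) (nextS a)))
           (e-offDiagonal (nextS a) a (nextS-irreflexive 1≤m a)) (e-offDiagonal a (nextS a) (λ eq → nextS-irreflexive 1≤m a (sym eq))))
    (cong₂ (λ x y → (x - 0ℚ) - (0ℚ - y)) (e-diagonal a) (e-diagonal (nextS a)))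

  edgeVec-jump-apart : ∀ a a' → a' ≢ a → edgeVec-jump a a' ≡ (0ℚ - e (nextS a) a') - (e a (nextS a') - 0ℚ)
  edgeVec-jump-apart a a' a'≢a =
    cong₂ (λ x y → (x - e (nextS a) a') - (e a (nextS a') - y))
          (e-offDiagonal a a' a'≢a) (e-offDiagonal (nextS a) (nextS a') (λ eq → a'≢a (nextS-injective a' a eq)))

  edgeVec-jump-other : ∀ a a' → a' ≢ a → edgeVec-jump a a' ≡ 0ℚ ⊎ edgeVec-jump a a' ≡ - 1ℚ
  edgeVec-jump-other a a' a'≢a = go (e-value (nextS a) a') (e-value a (nextS a'))
    where
    jump≡ : ∀ {x y} → e (nextS a) a' ≡ x → e a (nextS a') ≡ y → edgeVec-jump a a' ≡ (0ℚ - x) - (y - 0ℚ)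
    jump≡ x≡ y≡ = trans (edgeVec-jump-apart a a' a'≢a) (cong₂ (λ x y → (0ℚ - x) - (y - 0ℚ)) x≡ y≡)
    go : EValue (nextS a) a' → EValue a (nextS a') → edgeVec-jump a a' ≡ 0ℚ ⊎ edgeVec-jump a a' ≡ - 1ℚ
    go (inj₁ (a'≡ , _))   (inj₁ (a''≡a , _)) = ⊥-elim (nextS²-irreflexive 2≤m a (trans (cong nextS (sym a'≡)) a''≡a))
    go (inj₁ (_ , x≡1))   (inj₂ (_ , y≡0))   = inj₂ (jump≡ x≡1 y≡0)
    go (inj₂ (_ , x≡0))   (inj₁ (_ , y≡1))   = inj₂ (jump≡ x≡0 y≡1)
    go (inj₂ (_ , x≡0))   (inj₂ (_ , y≡0))   = inj₁ (jump≡ x≡0 y≡0)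

  gram-self : ∀ a s → dot (gen (genIdx a s)) (gen (genIdx a s)) ≡ two
  gram-self a s = trans (gram a s a s) (trans (cong₂ _*_ (sign*sign s) (edgeVec-jump-self a)) (*-identityˡ two))

  gram-other : ∀ a s l → l ≡ genIdx a s ⊎ dot (gen (genIdx a s)) (gen l) ≤ 1ℚ
  gram-other a s l with genIdx-surjective l
  ... | a' , s' , refl with a' Fin.≟ a | s' Data.Bool.≟ s
  ...   | yes refl | yes refl = inj₁ refl
  ...   | yes refl | no s'≢s  =
    inj₂ (subst (_≤ 1ℚ) (sym (trans (gram a s a s') (cong₂ _*_ (sign*sign-opposite s' s s'≢s) (edgeVec-jump-self a))))
                (toWitness {a? = _ ≤? _} _))
  ...   | no a'≢a  | _ = inj₂ (subst (_≤ 1ℚ) (sym (gram a s a' s')) (bounded (sign*sign-±1 s' s) (edgeVec-jump-other a a' a'≢a)))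
    where
    bounded : ∀ {k D} → Tight k 1ℚ → D ≡ 0ℚ ⊎ D ≡ - 1ℚ → k * D ≤ 1ℚ
    bounded (inj₁ refl) (inj₁ refl) = toWitness {a? = _ ≤? _} _
    bounded (inj₁ refl) (inj₂ refl) = toWitness {a? = _ ≤? _} _
    bounded (inj₂ refl) (inj₁ refl) = toWitness {a? = _ ≤? _} _
    bounded (inj₂ refl) (inj₂ refl) = toWitness {a? = _ ≤? _} _

  1<two : 1ℚ < two
  1<two = toWitness {a? = _ <? _} _

  gram≤two : ∀ a s l → dot (gen (genIdx a s)) (gen l) ≤ two
  gram≤two a s l with gram-other a s l
  ... | inj₁ refl = ≤-reflexive (gram-self a s)
  ... | inj₂ ≤1   = ≤-trans ≤1 (<⇒≤ 1<two)

  gram≡two⇒same : ∀ a s l → dot (gen (genIdx a s)) (gen l) ≡ two → l ≡ genIdx a s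
  gram≡two⇒same a s l ≡two with gram-other a s l
  ... | inj₁ l≡ = l≡
  ... | inj₂ ≤1 = ⊥-elim (<-irrefl refl (≤-<-trans (subst (_≤ 1ℚ) ≡two ≤1) 1<two))

module AdmissibleFaceVertices (m1 : ℕ) (σ : Fin (suc (suc m1)) → Bool) (b : Pt (suc (suc m1)))
                              (slope : ∀ a → b a - b (nextS a) ≡ sign (σ a)) (1≤m1 : 1 ℕ.≤ m1) where

  open Cycle (suc m1)
  open CycleGram (suc m1) (s≤s 1≤m1)
  open AdmissibleFace m1 σ b slope

  vertex : Fin n → Pt n
  vertex a = gen (tightIdx a)

  -- Vertex a is exposed in P by its own functional: it is the only generator g with vertex a · g = 2.
  Conv-exposed : ∀ a y (y∈P : P y) → dot (vertex a) y ≡ two → ∀ l → l ≢ tightIdx a → proj₁ y∈P l ≡ 0ℚ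
  Conv-exposed a y y∈P ≡two l l≢ =
    Data.Sum.[ id , (λ tight → ⊥-elim (l≢ (gram≡two⇒same a (σ a) l tight))) ]′
      (Conv-tight gen (vertex a) two (gram≤two a (σ a)) y y∈P ≡two l)

  vertex-IsVertex : ∀ a → IsVertex Face (vertex a)
  vertex-IsVertex a =
    Face-tight a , vertex a , two , (λ y y∈F → Conv-valid gen (vertex a) two (gram≤two a (σ a)) y (proj₁ y∈F)) ,
    gram-self a (σ a) , unique
    where
    unique : ∀ y → Face y → dot (vertex a) y ≡ two → y ≈P vertex a
    unique y (y∈P@(λs , _ , Σλ≡1 , y≡) , _) ≡two u = begin
      y u
        ≡⟨ y≡ u ⟩
      sumFin (λ l → λs l * gen l u)
        ≡⟨ sumFin-single (λ l → λs l * gen l u) (tightIdx a) (λ l l≢ → trans (cong (_* gen l u) (others≡0 l l≢)) (*-zeroˡ (gen l u))) ⟩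
      λs (tightIdx a) * vertex a u
        ≡⟨ cong (_* vertex a u) (trans (sym (sumFin-single λs (tightIdx a) others≡0)) Σλ≡1) ⟩
      1ℚ * vertex a u
        ≡⟨ *-identityˡ _ ⟩
      vertex a u ∎
      where open ≡-Reasoning
            others≡0 = Conv-exposed a y y∈P ≡two

  vertex-injective : ∀ a a' → vertex a ≈P vertex a' → a ≡ a'
  vertex-injective a a' eq = sym (proj₁ (genIdx-injective {a'} {a} {σ a'} {σ a}
    (gram≡two⇒same a (σ a) (tightIdx a') (trans (sym (dot-cong (vertex a) eq)) (gram-self a (σ a))))))

  -- x is the only point of the face on w = c; a tight generator carrying positive weight in x
  -- is forced onto w = c as well, so it is x.
  vertex-surjective : ∀ x → IsVertex Face x → ∃ λ a → vertex a ≈P x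
  vertex-surjective x (x∈F@(x∈P@(λs , λ≥0 , Σλ≡1 , _) , _) , w , c , w-valid , wx≡c , w-unique) =
    Data.Sum.[ (λ λ≡0 → ⊥-elim (1≢0 (trans (sym Σλ≡1) (sumFin-zero λ≡0)))) , uncurry positive-weight ]′ (allZero⊎nonZero λs)
    where
    slack-nonNeg : ∀ l → 0ℚ ≤ λs l * (c - dot w (gen l))
    slack-nonNeg l = Data.Sum.[ (λ λl≡0 → ≤-reflexive (sym (trans (cong (_* (c - dot w (gen l))) λl≡0) (*-zeroˡ (c - dot w (gen l))))))
                              , (λ (a , l≡a) → nonNeg*nonNeg (λ≥0 l) (p≤q⇒0≤q-p (w-valid (gen l) (subst (λ l → Face (gen l)) (sym l≡a) (Face-tight a))))) ]′
                              (Face-support x x∈F l)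
    slack≡0 : ∀ l → λs l * (c - dot w (gen l)) ≡ 0ℚ
    slack≡0 = sumFin-nonNeg≡0 (λ l → λs l * (c - dot w (gen l))) slack-nonNeg (Conv-slack-sum gen w c x x∈P wx≡c)
    positive-weight : ∀ l → λs l ≢ 0ℚ → ∃ λ a → vertex a ≈P x
    positive-weight l λl≢0 = Data.Sum.[ (λ λl≡0 → ⊥-elim (λl≢0 λl≡0)) , on-vertex ]′ (Face-support x x∈F l)
      where on-vertex : (∃ λ a → l ≡ tightIdx a) → ∃ λ a → vertex a ≈P x
            on-vertex (a , l≡a) = a , w-unique (vertex a) (Face-tight a)
              (sym (p-q≡0⇒p≡q (p*q≡0⇒q≡0 (subst (λ l → λs l ≢ 0ℚ) l≡a λl≢0) (slack≡0 (tightIdx a)))))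

  Face-vertices : HasNVertices Face n
  Face-vertices = vertex , vertex-IsVertex , vertex-injective , vertex-surjective

punchIn²-surjective : ∀ {m} (i0 : Fin (suc (suc m))) (r1 : Fin (suc m)) e →
  e ≢ i0 → e ≢ punchIn i0 r1 → ∃ λ r → punchIn i0 (punchIn r1 r) ≡ e
punchIn²-surjective i0 r1 e e≢i0 e≢i1 =
  punchOut r1≢e' , trans (cong (punchIn i0) (punchIn-punchOut r1≢e')) (punchIn-punchOut i0≢e)
  where
  i0≢e = λ i0≡e → e≢i0 (sym i0≡e)
  r1≢e' : r1 ≢ punchOut i0≢e
  r1≢e' r1≡ = e≢i1 (trans (sym (punchIn-punchOut i0≢e)) (cong (punchIn i0) (sym r1≡)))

SignClassified : ∀ {m} → PSet (suc m) → Set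
SignClassified {m} F = Σ (Fin (suc m) → Bool) λ σ → (sumFin (λ a → sign (σ a)) ≡ 0ℚ) ×
  (∀ b → (∀ a → b a - b (nextS a) ≡ sign (σ a)) → F ≐ (λ x → SEP (cycleEdges (suc m)) x × dot b x ≡ 1ℚ))

module FacetClassification (m1 : ℕ) (pred-odd : ∀ P Q → P ℕ.+ Q ≡ suc m1 → P ≢ Q)
                           {F : PSet (suc (suc m1))} (a : Pt (suc (suc m1))) (c : ℚ) where

  open Cycle (suc m1)

  module _ (a-valid : ∀ y → P y → dot a y ≤ c) (F≐ : F ≐ (λ x → P x × dot a x ≡ c)) (F-dim : HasDim F m1) where

    slope : Fin n → ℚ
    slope i = a i - a (nextS i)

    a-valid-gen : ∀ l → dot a (gen l) ≤ c
    a-valid-gen l = a-valid (gen l) (Conv-generator gen l)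

    slope≤c : ∀ i → slope i ≤ c
    slope≤c i = subst (_≤ c) (trans (dot-gen a i true) (*-identityˡ (slope i))) (a-valid-gen (genIdx i true))

    -c≤slope : ∀ i → - c ≤ slope i
    -c≤slope i = subst (- c ≤_) (⁻¹-involutive (slope i))
      (neg-antimono-≤ (subst (_≤ c) (trans (dot-gen a i false) (-1*x≡-x (slope i))) (a-valid-gen (genIdx i false))))

    c≢0 : c ≢ 0ℚ
    c≢0 c≡0 = proj₂ F-dim forward (λ i → proj₂ (F≐ (forward i)) (P⊆F (forward i) (Conv-generator gen (genIdx i true)))) forward-AffInd
      where
      slope≡0 : ∀ i → slope i ≡ 0ℚ
      slope≡0 i = ≤-antisym (subst (slope i ≤_) c≡0 (slope≤c i)) (subst (_≤ slope i) (cong -_ c≡0) (-c≤slope i))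
      gen-tight : ∀ l → dot a (gen l) ≡ 0ℚ * dot a (gen l)
      gen-tight l = trans (dot-gen-all a 0ℚ (λ i s → trans (cong (sign s *_) (slope≡0 i)) (*-zeroʳ (sign s))) l)
                          (sym (*-zeroˡ (dot a (gen l))))
      P⊆F : ∀ x → P x → P x × dot a x ≡ c
      P⊆F x x∈P = x∈P , trans (dot-Conv-proportional gen a a 0ℚ gen-tight x∈P) (trans (*-zeroˡ (dot a x)) (sym c≡0))

    c>0 : 0ℚ < c
    c>0 with <-cmp c 0ℚ
    ... | tri< c<0 _ _ = ⊥-elim (<-irrefl refl (<-≤-trans (<-trans c<0 (neg-antimono-< c<0)) (≤-trans (-c≤slope zero) (slope≤c zero))))
    ... | tri≈ _ c≡0 _ = ⊥-elim (c≢0 c≡0)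
    ... | tri> _ _ c>0 = c>0

    c≢-c : c ≢ - c
    c≢-c c≡-c = <-irrefl refl (<-trans c>0 (subst (_< 0ℚ) (sym c≡-c) (neg-antimono-< c>0)))

    -- The sign of edge i: gen (genIdx i (slopeSign i)) is the generator a can reach c on.
    slopeSign : Fin n → Bool
    slopeSign i = does (slope i ≟ c)

    gen-tight⇒sign : ∀ i s → sign s * slope i ≡ c → Tight (slope i) c × s ≡ slopeSign i
    gen-tight⇒sign i true 1*slope≡c = inj₁ slope≡c , sym (dec-true (slope i ≟ c) slope≡c)
      where slope≡c = trans (sym (*-identityˡ (slope i))) 1*slope≡c
    gen-tight⇒sign i false -1*slope≡c =
      inj₂ slope≡-c , sym (dec-false (slope i ≟ c) (λ slope≡c → c≢-c (trans (sym slope≡c) slope≡-c)))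
      where slope≡-c = -1*x≡c⇒x≡-c -1*slope≡c

    tight-gen : ∀ l → dot a (gen l) ≡ c → ∃ λ i → Tight (slope i) c × l ≡ genIdx i (slopeSign i)
    tight-gen = genIdx-elim (λ l → dot a (gen l) ≡ c → ∃ λ i → Tight (slope i) c × l ≡ genIdx i (slopeSign i)) λ i s tight →
      let (tight-i , s≡) = gen-tight⇒sign i s (trans (sym (dot-gen a i s)) tight) in i , tight-i , cong (genIdx i) s≡

    F-support : ∀ x (x∈F : F x) l →
      proj₁ (proj₁ (proj₁ (F≐ x) x∈F)) l ≡ 0ℚ ⊎ ∃ λ i → Tight (slope i) c × l ≡ genIdx i (slopeSign i)
    F-support x x∈F l = Data.Sum.map₂ (tight-gen l) (Conv-tight gen a c a-valid-gen x x∈P ax≡c l)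
      where x∈P = proj₁ (proj₁ (F≐ x) x∈F)
            ax≡c = proj₂ (proj₁ (F≐ x) x∈F)

    -- With two edges i0, i1 off the hyperplane, F lies in the affine span of the m1 tight
    -- generators of the other edges, which is too small for dimension m1.
    two-nonTight-impossible : ∀ i0 → ¬ Tight (slope i0) c → ∀ r1 → ¬ Tight (slope (punchIn i0 r1)) c → ⊥
    two-nonTight-impossible i0 ¬tight0 r1 ¬tight1 =
      spanned-NoAffInd gen tightOther F spanned (proj₁ has) (proj₁ (proj₂ has)) (proj₂ (proj₂ has))
      where
      has = proj₁ F-dim
      other : Fin m1 → Fin n
      other r = punchIn i0 (punchIn r1 r)
      tightOther : Fin m1 → Fin (n ℕ.+ n)
      tightOther r = genIdx (other r) (slopeSign (other r))
      tightOther-covers : ∀ {l} i → Tight (slope i) c → l ≡ genIdx i (slopeSign i) → ∃ λ r → tightOther r ≡ l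
      tightOther-covers i tight-i l≡ =
        let (r , other≡i) = punchIn²-surjective i0 r1 i (λ { refl → ¬tight0 tight-i }) (λ { refl → ¬tight1 tight-i })
        in r , trans (cong (λ j → genIdx j (slopeSign j)) other≡i) (sym l≡)
      spanned : ∀ x → F x → SpannedBy gen tightOther (NoExtra gen) x
      spanned x x∈F =
        let ((λs , _ , Σλ≡1 , x≡) , _) = proj₁ (F≐ x) x∈F
        in λs , Σλ≡1 , x≡ , λ l → Data.Sum.map₂ (λ (i , tight-i , l≡) → inj₂ (tightOther-covers i tight-i l≡)) (F-support x x∈F l)

    -- The slopes sum to 0 around the cycle; if all but one are ±c, the remaining one is
    -- c times an odd integer, hence ±c as well.
    one-nonTight-impossible : ∀ i0 → ¬ Tight (slope i0) c → (∀ r → Tight (slope (punchIn i0 r)) c) → ⊥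
    one-nonTight-impossible i0 ¬tight0 others-tight with sumFin-± (λ r → slope (punchIn i0 r)) c others-tight
    ... | P , Q , P+Q≡m , Σ≡ =
      ¬tight0 (balanced⇒tight (slope i0) c P Q c>0 (pred-odd P Q P+Q≡m)
                 (trans (cong (slope i0 +_) (sym Σ≡)) (trans (sym (sumFin-punchIn i0 slope)) (cyclic-telescope a)))
                 (-c≤slope i0) (slope≤c i0))

    all-tight : ∀ i → Tight (slope i) c
    all-tight with all? (λ i → tight? (slope i) c)
    ... | yes tight = tight
    ... | no ¬all with ¬∀⟶∃¬ n (λ i → Tight (slope i) c) (λ i → tight? (slope i) c) ¬all
    ...   | i0 , ¬tight0 with all? (λ r → tight? (slope (punchIn i0 r)) c)
    ...     | yes others-tight = ⊥-elim (one-nonTight-impossible i0 ¬tight0 others-tight)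
    ...     | no ¬all-others with ¬∀⟶∃¬ (suc m1) (λ r → Tight (slope (punchIn i0 r)) c) (λ r → tight? (slope (punchIn i0 r)) c) ¬all-others
    ...       | r1 , ¬tight1 = ⊥-elim (two-nonTight-impossible i0 ¬tight0 r1 ¬tight1)

    slope≡c*sign : ∀ i → slope i ≡ c * sign (slopeSign i)
    slope≡c*sign i = from-c (all-tight i)
      where
      from-c : Tight (slope i) c → slope i ≡ c * sign (slopeSign i)
      from-c (inj₁ slope≡c)  = trans slope≡c (trans (sym (*-identityʳ c)) (cong (λ s → c * sign s) (sym (dec-true (slope i ≟ c) slope≡c))))
      from-c (inj₂ slope≡-c) = trans slope≡-c (trans (solve 1 (λ c → :- c := c :* (:- con 1ℚ)) refl c)
                                 (cong (λ s → c * sign s) (sym (dec-false (slope i ≟ c) (λ slope≡c → c≢-c (trans (sym slope≡c) slope≡-c))))))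

    slopeSign-balanced : sumFin (λ i → sign (slopeSign i)) ≡ 0ℚ
    slopeSign-balanced = p*q≡0⇒q≡0 c≢0
      (trans (sym (sumFin-*ˡ c (λ i → sign (slopeSign i)))) (trans (sym (sumFin-cong slope≡c*sign)) (cyclic-telescope a)))

    facet≐face : ∀ b → (∀ i → b i - b (nextS i) ≡ sign (slopeSign i)) → F ≐ (λ x → P x × dot b x ≡ 1ℚ)
    facet≐face b b-slope x =
      (λ x∈F → let (x∈P , ax≡c) = proj₁ (F≐ x) x∈F in
               x∈P , *-cancelˡ-≡ (trans (sym (a≡c*b x∈P)) (trans ax≡c (sym (*-identityʳ c))))) ,
      (λ (x∈P , bx≡1) → proj₂ (F≐ x) (x∈P , trans (a≡c*b x∈P) (trans (cong (c *_) bx≡1) (*-identityʳ c))))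
      where
      a≡c*b : ∀ {x} → P x → dot a x ≡ c * dot b x
      a≡c*b = dot-Conv-proportional gen a b c (genIdx-elim (λ l → dot a (gen l) ≡ c * dot b (gen l)) proportional)
        where proportional : ∀ i s → dot a (gen (genIdx i s)) ≡ c * dot b (gen (genIdx i s))
              proportional i s = begin
                dot a (gen (genIdx i s))              ≡⟨ dot-gen a i s ⟩
                sign s * slope i                      ≡⟨ cong (sign s *_) (slope≡c*sign i) ⟩
                sign s * (c * sign (slopeSign i))     ≡⟨ x*[y*z]≡y*[x*z] (sign s) c (sign (slopeSign i)) ⟩
                c * (sign s * sign (slopeSign i))     ≡⟨ cong (λ z → c * (sign s * z)) (sym (b-slope i)) ⟩
                c * (sign s * (b i - b (nextS i)))    ≡⟨ cong (c *_) (sym (dot-gen b i s)) ⟩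
                c * dot b (gen (genIdx i s))          ∎
                where open ≡-Reasoning
      *-cancelˡ-≡ : ∀ {y z} → c * y ≡ c * z → y ≡ z
      *-cancelˡ-≡ {y} {z} cy≡cz = p-q≡0⇒p≡q (p*q≡0⇒q≡0 c≢0
        (trans (*-distribˡ-- c y z) (trans (cong (λ w → w - c * z) cy≡cz) (+-inverseʳ (c * z)))))

    classification : SignClassified F
    classification = slopeSign , slopeSign-balanced , facet≐face

module CycleFacets (m1 : ℕ) where

  open Cycle (suc m1)
  open Labelings (suc m1) hiding (n)

  module OfLabeling (v0 : Fin n) (f : Fin n → ℤ) (admissible : Admissible v0 f) where
    open AdmissibleFace m1 (signsOf f) (λ v → toℚ (f v)) (toℚ-Δ f (signsOf f) (Admissible⇒Δ≡signℤ v0 f admissible)) public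

    faceOf-IsFacet : IsFacet P (faceOf P f)
    faceOf-IsFacet = ((λ v → toℚ (f v)) , 1ℚ , (λ y → Conv-valid gen (λ v → toℚ (f v)) 1ℚ b-valid y) , (λ x → id , id)) ,
                     m1 , P-dim , Face-dim

  -- A face determines the signs: the tight generator of edge a for f lies on the face of g,
  -- so it is also tight for g.
  faceOf-injective : ∀ v0 (f g : Fin n → ℤ) → Admissible v0 f → Admissible v0 g →
    faceOf P f ≐ faceOf P g → ∀ v → f v ≡ g v
  faceOf-injective v0 f g adm-f adm-g f≐g = Δ-injective f g (trans (proj₁ adm-f) (sym (proj₁ adm-g))) λ a → begin
    Δ f a                ≡⟨ Admissible⇒Δ≡signℤ v0 f adm-f a ⟩
    signℤ (signsOf f a)  ≡⟨ cong signℤ (same-signs a) ⟩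
    signℤ (signsOf g a)  ≡⟨ sym (Admissible⇒Δ≡signℤ v0 g adm-g a) ⟩
    Δ g a                ∎
    where
    open ≡-Reasoning
    module Ff = OfLabeling v0 f adm-f
    module Fg = OfLabeling v0 g adm-g
    same-signs : ∀ a → signsOf f a ≡ signsOf g a
    same-signs a = Fg.b-tight⇒sign a (signsOf f a) (proj₂ (proj₁ (f≐g (gen (Ff.tightIdx a))) (Ff.Face-tight a)))

  module OfFacet (pred-odd : ∀ P Q → P ℕ.+ Q ≡ suc m1 → P ≢ Q) (v0 : Fin n) {F : PSet n} (F-facet : IsFacet P F) where

    classified : SignClassified F
    classified =
      let ((a , c , a-valid , F≐) , _ , P-dim' , F-dim) = F-facet in
      FacetClassification.classification m1 pred-odd a c a-valid F≐
        (subst (HasDim F) (ℕ.suc-injective (HasDim-unique P P-dim' P-dim)) F-dim)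

    signs : Fin n → Bool
    signs = proj₁ classified

    open FromSigns signs (proj₁ (proj₂ classified)) v0

    F≐faceOf : F ≐ faceOf P labeling
    F≐faceOf = proj₂ (proj₂ classified) (λ v → toℚ (labeling v)) (toℚ-Δ labeling signs Δ-labeling)

    labeling-facet : ∃ λ f → Admissible v0 f × (F ≐ faceOf P f)
    labeling-facet = labeling , labeling-Admissible , F≐faceOf

    facet-dim-vertices : 1 ℕ.≤ m1 → HasDim F m1 × HasNVertices F n
    facet-dim-vertices 1≤m1 = HasDim-resp-≐ (≐-sym F≐faceOf) Face-dim , HasNVertices-resp-≐ (≐-sym F≐faceOf) Face-vertices
      where
      open OfLabeling v0 labeling labeling-Admissible using (Face-dim)
      open AdmissibleFaceVertices m1 (signsOf labeling) (λ v → toℚ (labeling v))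
             (toℚ-Δ labeling (signsOf labeling) (Admissible⇒Δ≡signℤ v0 labeling labeling-Admissible)) 1≤m1

  module Counting (k : ℕ) (n≡k+k : n ≡ k ℕ.+ k) (pred-odd : ∀ P Q → P ℕ.+ Q ≡ suc m1 → P ≢ Q) (v0 : Fin n) where

    balanced : ∀ j → sumFin (λ a → sign (ofSize n k j a)) ≡ 0ℚ
    balanced j = trues≡half⇒balanced (ofSize n k j) n≡k+k (trues-ofSize n k j)

    labelingOf : Fin (n C k) → Fin n → ℤ
    labelingOf j = FromSigns.labeling (ofSize n k j) (balanced j) v0

    labelingOf-Admissible : ∀ j → Admissible v0 (labelingOf j)
    labelingOf-Admissible j = FromSigns.labeling-Admissible (ofSize n k j) (balanced j) v0

    facets : Fin (n C k) → PSet n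
    facets j = faceOf P (labelingOf j)

    facets-injective : ∀ j j' → facets j ≐ facets j' → j ≡ j'
    facets-injective j j' j≐j' = ofSize-injective n k j j' λ a → signℤ-injective (begin
      signℤ (ofSize n k j a)           ≡⟨ sym (FromSigns.Δ-labeling (ofSize n k j) (balanced j) v0 a) ⟩
      Δ (labelingOf j) a               ≡⟨ cong₂ ℤ._-_ (same a) (same (nextS a)) ⟩
      Δ (labelingOf j') a              ≡⟨ FromSigns.Δ-labeling (ofSize n k j') (balanced j') v0 a ⟩
      signℤ (ofSize n k j' a)          ∎)
      where open ≡-Reasoning
            same = faceOf-injective v0 (labelingOf j) (labelingOf j') (labelingOf-Admissible j) (labelingOf-Admissible j') j≐j'

    facets-surjective : ∀ F → IsFacet P F → ∃ λ j → F ≐ facets j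
    facets-surjective F F-facet = j , proj₂ (proj₂ classified) (λ v → toℚ (labelingOf j v))
        (λ a → trans (toℚ-Δ (labelingOf j) (ofSize n k j) (FromSigns.Δ-labeling (ofSize n k j) (balanced j) v0) a) (cong sign (j≡σ a)))
      where
      open OfFacet pred-odd v0 F-facet using (classified; signs)
      chosen = ofSize-surjective n k signs (balanced⇒trues≡half signs n≡k+k (proj₁ (proj₂ classified)))
      j = proj₁ chosen
      j≡σ = proj₂ chosen

corollary4p1 : (k : ℕ) → 2 ℕ.≤ k → (v0 : Fin (2 ℕ.* k)) →
    ((f : Fin (2 ℕ.* k) → ℤ) → Admissible v0 f →
    IsFacet (SEP (cycleEdges (2 ℕ.* k))) (faceOf (SEP (cycleEdges (2 ℕ.* k))) f)) ×
    ((f g : Fin (2 ℕ.* k) → ℤ) → Admissible v0 f → Admissible v0 g →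
    faceOf (SEP (cycleEdges (2 ℕ.* k))) f ≐ faceOf (SEP (cycleEdges (2 ℕ.* k))) g →
    ∀ v → f v ≡ g v) ×
    ((F : PSet (2 ℕ.* k)) → IsFacet (SEP (cycleEdges (2 ℕ.* k))) F →
    ∃ λ f → Admissible v0 f × (F ≐ faceOf (SEP (cycleEdges (2 ℕ.* k))) f)) ×
    (Σ (Fin ((2 ℕ.* k) C k) → PSet (2 ℕ.* k)) λ Fs →
    (∀ j → IsFacet (SEP (cycleEdges (2 ℕ.* k))) (Fs j)) ×
    (∀ j j' → Fs j ≐ Fs j' → j ≡ j') ×
    ((F : PSet (2 ℕ.* k)) → IsFacet (SEP (cycleEdges (2 ℕ.* k))) F → ∃ λ j → F ≐ Fs j)) ×
    ((F : PSet (2 ℕ.* k)) → IsFacet (SEP (cycleEdges (2 ℕ.* k))) F →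
    HasDim F (2 ℕ.* k ℕ.∸ 2) × HasNVertices F (2 ℕ.* k))
corollary4p1 k@(suc (suc k')) (s≤s (s≤s z≤n)) v0 =
  (λ f → OfLabeling.faceOf-IsFacet v0 f) ,
  faceOf-injective v0 ,
  (λ F F-facet → OfFacet.labeling-facet pred-odd v0 F-facet) ,
  (facets , (λ j → OfLabeling.faceOf-IsFacet v0 (labelingOf j) (labelingOf-Admissible j)) , facets-injective , facets-surjective) ,
  (λ F F-facet → OfFacet.facet-dim-vertices pred-odd v0 F-facet 1≤m1)
  where
  m1 = k' ℕ.+ (k ℕ.+ 0)
  open CycleFacets m1
  n≡k+k : 2 ℕ.* k ≡ k ℕ.+ k
  n≡k+k = cong (k ℕ.+_) (ℕ.+-identityʳ k)
  pred-odd : ∀ P Q → P ℕ.+ Q ≡ suc m1 → P ≢ Q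
  pred-odd P Q P+Q≡ refl = 1+m+m≢n+n P k (trans (cong suc P+Q≡) n≡k+k)
  1≤m1 : 1 ℕ.≤ m1
  1≤m1 = ℕ.≤-trans (s≤s z≤n) (ℕ.m≤n+m (k ℕ.+ 0) k')
  open Counting k n≡k+k pred-odd v0
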